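{- Let $W\subseteq[0,1]\cap\mathbb Q$ be finite with $0\in W$ and $k=|W|\geq 2$. Let $\mathscr F=\{\mathcal{F}_n\}_{n\in\mathbb N}$ be an unsatisfiable family (each $\mathcal{F}_n$ an unsatisfiable set of integer linear inequalities over $\nu(n)\geq n$ variables) which is almost full (with respect to $W$) and $c$-self-reducible for a positive constant $c$. If $\mathcal{F}_n$ defines a feasible linear program (over $\mathbb R$) whenever $n>n_{\mathscr F}$, then for $n$ large enough the shortest Stabbing Planes refutation of $\mathcal{F}_n$ has length $\Omega(n^{1/4})$.
   Context: A set of integer linear inequalities is unsatisfiable if no $0/1$ assignment satisfies all of them. A $(N,W)$-word is an element of $W^N$; it is admissible for $\mathcal{F}$ (over $N$ variables) if it satisfies all inequalities of $\mathcal{F}$; $\mathcal{A}(\mathcal{F},W)$ is the set of admissible $(N,W)$-words. $\mathscr F$ is almost full if $|\mathcal{A}(\mathcal{F}_n,W)|\geq k^{\nu(n)}-o(k^{\nu(n)})$; then $n_{\mathscr F}$ denotes a natural number with $k^{\nu(n)}/|\mathcal{A}(\mathcal{F}_n,W)|\leq 2$ for all $n\geq n_{\mathscr F}$. A restriction is a map $\rho:D\to\{0,1\}$ on a subset $D$ of the variables; applying it to an inequality substitutes the values for the variables in $D$, and $\mathcal{F}\restriction_\rho$ denotes the set of restricted inequalities. $\mathscr F$ is $c$-self-reducible if for every set $V$ of variables of $\mathcal{F}_n$ with $|V|=v<n/c$ there is a restriction $\rho$ with domain $V'\supseteq V$ such that $\mathcal{F}_n\restriction_\rho=\mathcal{F}_{n-cv}$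 up to renaming of variables. A Stabbing Planes (SP) refutation of an unsatisfiable set $\mathcal{F}$ of integer linear inequalities in variables $x_1,\dots,x_N$ is a binary tree in which each internal node is labelled by a query $(\mathbf a,b)$ with $\mathbf a\in\mathbb Z^N$, $b\in\mathbb Z$, its two outgoing edges being labelled $\mathbf a\mathbf x\geq b$ and $\mathbf a\mathbf x\leq b-1$, such that for every leaf the linear program consisting of $\mathcal{F}$ together with the inequalities on the edges of the root-to-leaf path is infeasible over $\mathbb R$. Its length is the number of queries. -}

module Defs where

open import Data.Nat as ℕ using (ℕ; zero; suc; _^_; _∸_)
open import Data.Integer as ℤ using (ℤ; +_)
open import Data.Rational as ℚ using (ℚ; 0ℚ; 1ℚ)
open import Data.Rational.Properties as ℚP using ()
open import Data.Fin using (Fin)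
open import Data.Fin.Subset using (Subset; _∈_)
open import Data.Vec as Vec using (Vec; []; _∷_; lookup; tabulate; zipWith; foldr)
open import Data.List as List using (List; length; filter; map; concatMap)
open import Data.List.Relation.Unary.All as All using (All; all?)
open import Data.List.Relation.Unary.Any using (Any)
import Data.List.Membership.Propositional as LMem
open import Data.Bool using (Bool; true; false)
open import Data.Maybe using (Maybe; just; nothing)
open import Data.Product using (Σ; ∃; _×_; _,_)
open import Data.Sum using (_⊎_)
open import Relation.Binary.PropositionalEquality using (_≡_; _≢_)
open import Relation.Nullary using (¬_; Dec)
open import Function.Definitions using (Injective)

record Ineq (N : ℕ) : Set where
  constructor ineq
  field
    coeffs : Vec ℤ N
    bound  : ℤ
open Ineq public

ℤ→ℚ : ℤ → ℚ
ℤ→ℚ z = z ℚ./ 1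

dotℚ : ∀ {N} → Vec ℤ N → Vec ℚ N → ℚ
dotℚ a x = foldr (λ _ → ℚ) ℚ._+_ 0ℚ (zipWith (λ ai xi → ℤ→ℚ ai ℚ.* xi) a x)

Sat : ∀ {N} → Vec ℚ N → Ineq N → Set
Sat x I = ℤ→ℚ (bound I) ℚ.≤ dotℚ (coeffs I) x

sat? : ∀ {N} (x : Vec ℚ N) (I : Ineq N) → Dec (Sat x I)
sat? x I = ℤ→ℚ (bound I) ℚP.≤? dotℚ (coeffs I) x

SatAll : ∀ {N} → Vec ℚ N → List (Ineq N) → Set
SatAll x F = All (Sat x) F

satAll? : ∀ {N} (F : List (Ineq N)) (x : Vec ℚ N) → Dec (SatAll x F)
satAll? F x = all? (sat? x) F

bool→ℚ : Bool → ℚ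
bool→ℚ true  = 1ℚ
bool→ℚ false = 0ℚ

Unsatisfiable : ∀ {N} → List (Ineq N) → Set
Unsatisfiable {N} F = (x : Vec Bool N) → ¬ SatAll (Vec.map bool→ℚ x) F

-- feasible as a linear program (point with rational coordinates)
LPFeasible : ∀ {N} → List (Ineq N) → Set
LPFeasible {N} F = Σ (Vec ℚ N) λ x → SatAll x F

words : List ℚ → (N : ℕ) → List (Vec ℚ N)
words W zero    = [] List.∷ List.[]
words W (suc N) = concatMap (λ w → map (w ∷_) (words W N)) W

numAdmissible : ∀ {N} → List (Ineq N) → List ℚ → ℕ
numAdmissible F W = length (filter (satAll? F) (words W _))

record Family : Set where
  field
    ν : ℕ → ℕ
    F : (n : ℕ) → List (Ineq (ν n))
open Family public

UnsatisfiableFamily : Family → Set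
UnsatisfiableFamily 𝓕 = (n : ℕ) → (n ℕ.≤ ν 𝓕 n) × Unsatisfiable (F 𝓕 n)

-- almost full: k^ν(n) − |A(F_n,W)| = o(k^ν(n)),
-- i.e. for every m ≥ 1 eventually m·(k^ν(n) − |A|) ≤ k^ν(n)
AlmostFull : Family → List ℚ → Set
AlmostFull 𝓕 W =
  (m : ℕ) → ∃ λ n₀ → (n : ℕ) → n₀ ℕ.≤ n →
    m ℕ.* (length W ^ ν 𝓕 n ∸ numAdmissible (F 𝓕 n) W) ℕ.≤ length W ^ ν 𝓕 n

-- n₀ is a valid choice of n_𝓕 : k^ν(n)/|A| ≤ 2 for all n ≥ n₀
IsNF : Family → List ℚ → ℕ → Set
IsNF 𝓕 W n₀ = (n : ℕ) → n₀ ℕ.≤ n →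
  length W ^ ν 𝓕 n ℕ.≤ 2 ℕ.* numAdmissible (F 𝓕 n) W

-- a partial map ρ : D → {0,1}; D = { i | ρ i ≢ nothing }
Restriction : ℕ → Set
Restriction N = Fin N → Maybe Bool

maybeVal : Maybe Bool → ℤ
maybeVal (just true) = + 1
maybeVal _           = + 0

fixedPart : ∀ {N} → Vec ℤ N → Restriction N → ℤ
fixedPart a ρ = foldr (λ _ → ℤ) ℤ._+_ (+ 0) (zipWith ℤ._*_ a (tabulate (λ i → maybeVal (ρ i))))

restrictRename : ∀ {N M} → Restriction N → (Fin M → Fin N) → Ineq N → Ineq M
restrictRename ρ σ (ineq a b) =
  ineq (tabulate (λ j → lookup a (σ j))) (b ℤ.- fixedPart a ρ)

-- a constant inequality 0 ≥ b' with b' ≤ 0 (satisfied, hence removed)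
TriviallyTrue : ∀ {M} → Ineq M → Set
TriviallyTrue {M} (ineq a b) = (a ≡ Vec.replicate M (+ 0)) × (b ℤ.≤ + 0)

IsRenaming : ∀ {N M} → Restriction N → (Fin M → Fin N) → Set
IsRenaming {N} ρ σ =
  Injective _≡_ _≡_ σ × ((i : Fin N) → (ρ i ≡ nothing) → ∃ λ j → σ j ≡ i)
                       × (∀ j → ρ (σ j) ≡ nothing)

-- F↾ρ = G up to renaming σ (as sets; trivially satisfied inequalities dropped)
RestrictsTo : ∀ {N M} → List (Ineq N) → Restriction N → (Fin M → Fin N) →
              List (Ineq M) → Set
RestrictsTo F ρ σ G =
  All (λ I → TriviallyTrue (restrictRename ρ σ I) ⊎
             restrictRename ρ σ I LMem.∈ G) F
  × All (λ J → Any (λ I → restrictRename ρ σ I ≡ J) F) G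

SelfReducible : ℕ → Family → Set
SelfReducible c 𝓕 =
  (n : ℕ) (V : Subset (ν 𝓕 n)) → c ℕ.* Data.Fin.Subset.∣ V ∣ ℕ.< n →
  Σ (Restriction (ν 𝓕 n)) λ ρ →
    ((i : Fin (ν 𝓕 n)) → i ∈ V → ρ i ≢ nothing) ×
    Σ (Fin (ν 𝓕 (n ∸ c ℕ.* Data.Fin.Subset.∣ V ∣)) → Fin (ν 𝓕 n)) λ σ →
      IsRenaming ρ σ × RestrictsTo (F 𝓕 n) ρ σ (F 𝓕 (n ∸ c ℕ.* Data.Fin.Subset.∣ V ∣))

data SPTree (N : ℕ) : Set where
  leaf : SPTree N
  query : (a : Vec ℤ N) (b : ℤ) (yes no : SPTree N) → SPTree N

spLength : ∀ {N} → SPTree N → ℕ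
spLength leaf = 0
spLength (query a b t u) = suc (spLength t ℕ.+ spLength u)

-- every leaf: F ∪ (path constraints) is LP-infeasible
-- path is the list of inequalities on the edges from the root
ValidSP : ∀ {N} → List (Ineq N) → List (Ineq N) → SPTree N → Set
ValidSP F path leaf = ¬ LPFeasible (path List.++ F)
ValidSP F path (query a b t u) =
  ValidSP F (ineq a b List.∷ path) t ×
  ValidSP F (ineq (Vec.map ℤ.-_ a) (+ 1 ℤ.- b) List.∷ path) u          -- a·x ≤ b − 1

SPRefutation : ∀ {N} → List (Ineq N) → SPTree N → Set
SPRefutation F T = ValidSP F List.[] T

ValidW : List ℚ → Set
ValidW W = Data.List.Relation.Unary.Unique.Propositional.Unique W
         × 0ℚ LMem.∈ W
         × All (λ w → (0ℚ ℚ.≤ w) × (w ℚ.≤ 1ℚ)) W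
         × (2 ℕ.≤ length W)
  where import Data.List.Relation.Unary.Unique.Propositional

-- A query a·x ≥ b of a Stabbing Planes refutation leaves uncovered only the slab b - 1 < a·x < b,
-- and every admissible word falls into the slab of some query.  If a has at least m nonzero
-- coefficients, the Erdős–Kleitman chain argument behind the Littlewood–Offord lemma (with the
-- cyclically consecutive letters of W in place of {0,1}) shows that the slab contains at most an
-- O(1/√m) fraction of all k^ν words.  Queries on fewer than m variables are removed one at a time
-- by self-reducibility, fixing their variables at a cost of c·m in n.  For a refutation of length s
-- take m ≈ s²: the at most s rounds cost O(s³), and afterwards the s slabs cover only an
-- O(s/√m) < 1/2 fraction of the words, although at least half of them are admissible.
-- Hence n = O(s⁴).

module Submission where

open import Defs
open import Data.Nat using (ℕ; _≤_; _<_; _*_; _^_; _≥_)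
open import Data.Rational using (ℚ)
open import Data.List using (List)
open import Data.Product using (Σ; ∃; _×_)

import Algebra.Properties.CommutativeMonoid.Sum as CommutativeMonoidSum
open import Data.Bool using (Bool; true; false; T; not; _∧_)
open import Data.Bool.Properties using (T-∧)
open import Data.Empty using (⊥-elim)
open import Data.Fin as Fin using (Fin; punchIn; punchOut)
import Data.Fin.Properties as Fin
open import Data.Fin.Subset using (Subset; inside; outside; ∣_∣; _∈_)
open import Data.Integer as ℤ using (ℤ; 0ℤ; 1ℤ; -[1+_]; +[1+_])
import Data.Integer.Properties as ℤP
open import Data.Integer.Solver renaming (module +-*-Solver to ℤ-Solver)
open import Data.List using ([]; _∷_; _++_; _∷ʳ_; map; concatMap; length; zip; foldr; filter)
import Data.List.Membership.Propositional as Membership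
import Data.List.Properties as List
open import Data.List.Relation.Binary.Permutation.Propositional using (↭-sym)
import Data.List.Relation.Binary.Permutation.Propositional.Properties as Perm
open import Data.List.Relation.Unary.All as All using (All; []; _∷_)
import Data.List.Relation.Unary.All.Properties as All
open import Data.List.Relation.Unary.AllPairs using ([]; _∷_)
open import Data.List.Relation.Unary.Any as Any using (Any; here; there; any?)
import Data.List.Relation.Unary.Any.Properties as Any
open import Data.List.Relation.Unary.Linked as Linked using (Linked; []; [-]; _∷_)
open import Data.List.Relation.Unary.Unique.Propositional using (Unique)
open import Data.Maybe using (just; nothing)
open import Data.Nat using (NonZero; >-nonZero; zero; suc; pred; _+_; _∸_; _⊓_; _<ᵇ_; z≤n; s≤s; ⌊_/2⌋; ⌈_/2⌉; _≤?_; _<?_)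
open import Data.Nat.Combinatorics using (_C_; nCk+nC[k+1]≡[n+1]C[k+1]; nCk≡nC[n∸k]; nC1≡n)
import Data.Nat.Coprimality as Coprimality
open import Data.Nat.ListAction using (sum)
open import Data.Nat.ListAction.Properties using (sum-++; sum-↭)
open import Data.Nat.Properties
open import Data.Nat.Tactic.RingSolver using (solve-∀)
open import Algebra.Properties.CommutativeSemigroup +-commutativeSemigroup using (interchange)
open import Data.Product using (_,_; proj₁; proj₂)
open import Data.Rational as ℚ using (0ℚ; 1ℚ; mkℚ; toℚᵘ)
import Data.Rational.Properties as ℚP
open import Algebra.Definitions.RawMonoid ℚ.+-0-rawMonoid using () renaming (_×_ to _·_)
open import Data.Rational.Solver renaming (module +-*-Solver to ℚ-Solver)
open import Data.Rational.Unnormalised as ℚᵘ using (mkℚᵘ; *≡*)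
import Data.Rational.Unnormalised.Properties as ℚᵘP
open import Data.Sum using (_⊎_; inj₁; inj₂)
open import Data.Unit using (tt)
open import Data.Vec as Vec using (Vec; lookup; tabulate)
import Data.Vec.Properties as Vec
open import Function using (_∘_; const)
open import Function.Bundles using (Equivalence)
open import Function.Definitions using (Injective)
open import Relation.Binary.Definitions using (Transitive; tri<; tri≈; tri>)
open import Relation.Binary.PropositionalEquality
open import Relation.Nullary using (¬_; Dec; yes; no; does; contradiction)
open import Relation.Nullary.Decidable using (T?; dec-true; dec-false)

private
  variable
    A B : Set

T-does : ∀ {X : Set} (x? : Dec X) → X → T (does x?)
T-does x? x = subst T (sym (dec-true x? x)) tt

T-does⁻¹ : ∀ {X : Set} (x? : Dec X) → T (does x?) → X
T-does⁻¹ (yes x) _ = x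

indicator : Bool → ℕ
indicator true  = 1
indicator false = 0

count : (A → Bool) → List A → ℕ
count P = sum ∘ map (indicator ∘ P)

sum-map-mono : {f g : A → ℕ} {xs : List A} → All (λ x → f x ≤ g x) xs →
               sum (map f xs) ≤ sum (map g xs)
sum-map-mono []       = z≤n
sum-map-mono (p ∷ ps) = +-mono-≤ p (sum-map-mono ps)

sum-map-+ : (f g : A → ℕ) (xs : List A) →
            sum (map (λ x → f x + g x) xs) ≡ sum (map f xs) + sum (map g xs)
sum-map-+ f g []       = refl
sum-map-+ f g (x ∷ xs) = begin
  f x + g x + sum (map (λ x → f x + g x) xs)   ≡⟨ cong ((f x + g x) +_) (sum-map-+ f g xs) ⟩
  f x + g x + (sum (map f xs) + sum (map g xs)) ≡⟨ interchange (f x) (g x) _ _ ⟩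
  f x + sum (map f xs) + (g x + sum (map g xs)) ∎
  where open ≡-Reasoning

*-distribˡ-sum-map : ∀ n (f : A → ℕ) xs → n * sum (map f xs) ≡ sum (map ((n *_) ∘ f) xs)
*-distribˡ-sum-map n f []       = *-zeroʳ n
*-distribˡ-sum-map n f (x ∷ xs) =
  trans (*-distribˡ-+ n (f x) (sum (map f xs))) (cong (n * f x +_) (*-distribˡ-sum-map n f xs))

sum-map-const : ∀ n (xs : List A) → sum (map (const n) xs) ≡ length xs * n
sum-map-const n []       = refl
sum-map-const n (x ∷ xs) = cong (n +_) (sum-map-const n xs)

sum-map-concatMap : (f : B → ℕ) (g : A → List B) (xs : List A) →
                    sum (map f (concatMap g xs)) ≡ sum (map (sum ∘ map f ∘ g) xs)
sum-map-concatMap f g []       = refl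
sum-map-concatMap f g (x ∷ xs) = begin
  sum (map f (g x ++ concatMap g xs))              ≡⟨ cong sum (List.map-++ f (g x) _) ⟩
  sum (map f (g x) ++ map f (concatMap g xs))      ≡⟨ sum-++ (map f (g x)) _ ⟩
  sum (map f (g x)) + sum (map f (concatMap g xs)) ≡⟨ cong (sum (map f (g x)) +_) (sum-map-concatMap f g xs) ⟩
  sum (map f (g x)) + sum (map (sum ∘ map f ∘ g) xs) ∎
  where open ≡-Reasoning

count-map : (P : B → Bool) (f : A → B) (xs : List A) → count P (map f xs) ≡ count (P ∘ f) xs
count-map P f xs = cong sum (sym (List.map-∘ xs))

indicator-mono : ∀ {b c} → (T b → T c) → indicator b ≤ indicator c
indicator-mono {false}         _   = z≤n
indicator-mono {true}  {true}  _   = ≤-refl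
indicator-mono {true}  {false} b⇒c = ⊥-elim (b⇒c tt)

count-cong : {P Q : A → Bool} → (∀ x → P x ≡ Q x) → ∀ xs → count P xs ≡ count Q xs
count-cong P≗Q xs = cong sum (List.map-cong (cong indicator ∘ P≗Q) xs)

count-mono : {P Q : A → Bool} → (∀ x → T (P x) → T (Q x)) → ∀ xs → count P xs ≤ count Q xs
count-mono P⇒Q xs = sum-map-mono {xs = xs} (All.tabulate λ {x} _ → indicator-mono (P⇒Q x))

count-≤-length : (P : A → Bool) (xs : List A) → count P xs ≤ length xs
count-≤-length P []       = z≤n
count-≤-length P (x ∷ xs) with P x
... | true  = s≤s (count-≤-length P xs)
... | false = m≤n⇒m≤1+n (count-≤-length P xs)

count-mono-< : {P Q : A → Bool} → (∀ x → T (P x) → T (Q x)) → ∀ {xs} →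
               Any (λ x → ¬ T (P x) × T (Q x)) xs → count P xs < count Q xs
count-mono-< {P = P} {Q} P⇒Q {x ∷ xs} (here (¬Px , Qx)) with P x | Q x
... | false | true  = s≤s (count-mono P⇒Q xs)
... | true  | _     = ⊥-elim (¬Px tt)
count-mono-< P⇒Q {x ∷ xs} (there any) =
  +-mono-≤-< (indicator-mono (P⇒Q x)) (count-mono-< P⇒Q any)

count-none : {P : A → Bool} → (∀ x → ¬ T (P x)) → ∀ xs → count P xs ≡ 0
count-none ¬P []       = refl
count-none ¬P (x ∷ xs) = cong₂ _+_ (indicator-none (¬P x)) (count-none ¬P xs)
  where
  indicator-none : ∀ {b} → ¬ T b → indicator b ≡ 0
  indicator-none {false} _  = refl
  indicator-none {true}  ¬b = ⊥-elim (¬b tt)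

count-pos : {P : A → Bool} → ∀ {xs} → Any (T ∘ P) xs → 0 < count P xs
count-pos {P = P} {x ∷ xs} (here Px) = ≤-trans (indicator-mono {true} (const Px)) (m≤m+n _ _)
count-pos {P = P} {x ∷ xs} (there any) = ≤-trans (count-pos any) (m≤n+m _ (indicator (P x)))

length-filter : {P : A → Set} (P? : ∀ x → Dec (P x)) (xs : List A) → length (filter P? xs) ≡ count (does ∘ P?) xs
length-filter P? []       = refl
length-filter P? (x ∷ xs) with does (P? x)
... | true  = cong suc (length-filter P? xs)
... | false = length-filter P? xs

count-≤-sum : (P : A → Bool) (R : B → A → Bool) (qs : List B) →
              (∀ x → T (P x) → Any (λ q → T (R q x)) qs) →
              ∀ xs → count P xs ≤ sum (map (λ q → count (R q) xs) qs)
count-≤-sum P R qs cover []       = ≤-reflexive (sym (trans (sum-map-const 0 qs) (*-zeroʳ (length qs))))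
count-≤-sum P R qs cover (x ∷ xs) = begin
  indicator (P x) + count P xs
    ≤⟨ +-mono-≤ head (count-≤-sum P R qs cover xs) ⟩
  sum (map (λ q → indicator (R q x)) qs) + sum (map (λ q → count (R q) xs) qs)
    ≡⟨ sum-map-+ (λ q → indicator (R q x)) (λ q → count (R q) xs) qs ⟨
  sum (map (λ q → count (R q) (x ∷ xs)) qs) ∎
  where
  open ≤-Reasoning
  head : indicator (P x) ≤ count (λ q → R q x) qs
  head with P x in Px
  ... | true  = count-pos (cover x (subst T (sym Px) tt))
  ... | false = z≤n

rotate : List A → List A
rotate []       = []
rotate (x ∷ xs) = xs ∷ʳ x

cyclicPairs : List A → List (A × A)
cyclicPairs xs = zip xs (rotate xs)

length-rotate : (xs : List A) → length (rotate xs) ≡ length xs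
length-rotate []       = refl
length-rotate (x ∷ xs) = trans (List.length-++ xs) (+-comm (length xs) 1)

length-cyclicPairs : (xs : List A) → length (cyclicPairs xs) ≡ length xs
length-cyclicPairs xs =
  trans (List.length-zipWith _,_ xs (rotate xs)) (trans (cong (length xs ⊓_) (length-rotate xs)) (⊓-idem (length xs)))

sum-map-zip : (f g : A → ℕ) (xs ys : List A) → length xs ≡ length ys →
              sum (map (λ (x , y) → f x + g y) (zip xs ys)) ≡ sum (map f xs) + sum (map g ys)
sum-map-zip f g []       []       _  = refl
sum-map-zip f g (x ∷ xs) (y ∷ ys) eq = begin
  f x + g y + sum (map (λ (x , y) → f x + g y) (zip xs ys)) ≡⟨ cong ((f x + g y) +_) (sum-map-zip f g xs ys (suc-injective eq)) ⟩
  f x + g y + (sum (map f xs) + sum (map g ys))             ≡⟨ interchange (f x) (g y) _ _ ⟩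
  f x + sum (map f xs) + (g y + sum (map g ys))             ∎
  where open ≡-Reasoning

sum-map-cyclicPairs : (f : A → ℕ) (xs : List A) →
                      sum (map (λ (x , y) → f x + f y) (cyclicPairs xs)) ≡ 2 * sum (map f xs)
sum-map-cyclicPairs f xs = begin
  sum (map (λ (x , y) → f x + f y) (cyclicPairs xs)) ≡⟨ sum-map-zip f f xs (rotate xs) (sym (length-rotate xs)) ⟩
  sum (map f xs) + sum (map f (rotate xs))           ≡⟨ cong (sum (map f xs) +_) (sum-map-rotate xs) ⟩
  sum (map f xs) + sum (map f xs)                    ≡⟨ cong (sum (map f xs) +_) (+-identityʳ _) ⟨
  2 * sum (map f xs)                                 ∎
  where
  open ≡-Reasoning
  sum-map-rotate : ∀ xs → sum (map f (rotate xs)) ≡ sum (map f xs)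
  sum-map-rotate []       = refl
  sum-map-rotate (x ∷ xs) = sum-↭ (Perm.map⁺ f (↭-sym (Perm.∷↭∷ʳ x xs)))

cyclicPairs-distinct : (xs : List A) → Unique xs → 2 ≤ length xs → All (λ (x , y) → x ≢ y) (cyclicPairs xs)
cyclicPairs-distinct []       _ ()
cyclicPairs-distinct (_ ∷ []) _ (s≤s ())
cyclicPairs-distinct (x₀ ∷ x₁ ∷ xs) ((x₀∉ ∷ x₀∉′) ∷ unique) _ = x₀∉ ∷ zip-distinct x₁ xs unique (x₀∉ ∷ x₀∉′)
  where
  zip-distinct : ∀ y ys → Unique (y ∷ ys) → All (x₀ ≢_) (y ∷ ys) → All (λ (x , y) → x ≢ y) (zip (y ∷ ys) (ys ∷ʳ x₀))
  zip-distinct y []        _                   (x₀≢y ∷ []) = (x₀≢y ∘ sym) ∷ []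
  zip-distinct y (y′ ∷ ys) ((y≢y′ ∷ _) ∷ unique) (_ ∷ x₀∉)  = y≢y′ ∷ zip-distinct y′ ys unique x₀∉

-- Binomial coefficients and chains in the cube

C-mono : ∀ n k → n C k ≤ suc n C k
C-mono n zero    = ≤-refl
C-mono n (suc k) = ≤-trans (m≤n+m (n C suc k) (n C k)) (≤-reflexive (nCk+nC[k+1]≡[n+1]C[k+1] n k))

C-absorption : ∀ n k → (suc n C suc k) * suc k ≡ suc n * (n C k)
C-absorption zero    zero    = refl
C-absorption zero    (suc k) = refl
C-absorption (suc n) zero    = trans (*-identityʳ _) (trans (nC1≡n (suc (suc n))) (sym (*-identityʳ _)))
C-absorption (suc n) (suc k) = begin
  (suc (suc n) C suc (suc k)) * suc (suc k)
    ≡⟨ cong (_* suc (suc k)) (nCk+nC[k+1]≡[n+1]C[k+1] (suc n) (suc k)) ⟨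
  (c₁ + (suc n C suc (suc k))) * suc (suc k)
    ≡⟨ *-distribʳ-+ (suc (suc k)) c₁ _ ⟩
  c₁ * suc (suc k) + (suc n C suc (suc k)) * suc (suc k)
    ≡⟨ cong₂ _+_ (*-suc c₁ (suc k)) (C-absorption n (suc k)) ⟩
  (c₁ + c₁ * suc k) + suc n * (n C suc k)
    ≡⟨ cong (λ z → (c₁ + z) + suc n * (n C suc k)) (C-absorption n k) ⟩
  (c₁ + suc n * (n C k)) + suc n * (n C suc k)
    ≡⟨ +-assoc c₁ _ _ ⟩
  c₁ + (suc n * (n C k) + suc n * (n C suc k))
    ≡⟨ cong (c₁ +_) (*-distribˡ-+ (suc n) (n C k) _) ⟨
  c₁ + suc n * ((n C k) + (n C suc k))
    ≡⟨ cong (λ z → c₁ + suc n * z) (nCk+nC[k+1]≡[n+1]C[k+1] n k) ⟩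
  suc (suc n) * c₁ ∎
  where
  open ≡-Reasoning
  c₁ = suc n C suc k

C-middle-sym : ∀ n → n C ⌊ n /2⌋ ≡ n C ⌈ n /2⌉
C-middle-sym n = trans (nCk≡nC[n∸k] (⌊n/2⌋≤n n)) (cong (n C_) n∸⌊n/2⌋≡⌈n/2⌉)
  where
  n∸⌊n/2⌋≡⌈n/2⌉ : n ∸ ⌊ n /2⌋ ≡ ⌈ n /2⌉
  n∸⌊n/2⌋≡⌈n/2⌉ = trans (cong (_∸ ⌊ n /2⌋) (sym (⌊n/2⌋+⌈n/2⌉≡n n))) (m+n∸m≡n ⌊ n /2⌋ ⌈ n /2⌉)

central-C : ℕ → ℕ
central-C a = (a + a) C a

central-C-suc : ∀ a → central-C (suc a) * suc a ≡ 2 * suc (a + a) * central-C a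
central-C-suc a = *-cancelʳ-≡ _ _ (suc a) (begin
  central-C (suc a) * suc a * suc a
    ≡⟨ cong (λ n → (n C suc a) * suc a * suc a) (cong suc (+-suc a a)) ⟩
  (suc (suc (a + a)) C suc a) * suc a * suc a
    ≡⟨ cong (_* suc a) (C-absorption (suc (a + a)) a) ⟩
  suc (suc (a + a)) * (suc (a + a) C a) * suc a
    ≡⟨ *-assoc (suc (suc (a + a))) (suc (a + a) C a) (suc a) ⟩
  suc (suc (a + a)) * ((suc (a + a) C a) * suc a)
    ≡⟨ cong (λ c → suc (suc (a + a)) * (c * suc a)) C-middle-sym′ ⟩
  suc (suc (a + a)) * ((suc (a + a) C suc a) * suc a)
    ≡⟨ cong (suc (suc (a + a)) *_) (C-absorption (a + a) a) ⟩
  suc (suc (a + a)) * (suc (a + a) * central-C a)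
    ≡⟨ rearrange a (central-C a) ⟩
  2 * suc (a + a) * central-C a * suc a ∎)
  where
  open ≡-Reasoning
  C-middle-sym′ : suc (a + a) C a ≡ suc (a + a) C suc a
  C-middle-sym′ = trans (nCk≡nC[n∸k] (m≤n⇒m≤1+n (m≤m+n a a))) (cong (suc (a + a) C_) (m+n∸n≡m (suc a) a))
  rearrange : ∀ a c → (2 + (a + a)) * ((1 + (a + a)) * c) ≡ 2 * (1 + (a + a)) * c * (1 + a)
  rearrange = solve-∀

central-C-bound : ∀ a → central-C a * central-C a * suc (a + a) ≤ 16 ^ a
central-C-bound zero    = ≤-refl
central-C-bound (suc a) = *-cancelʳ-≤ _ _ (suc a * suc a) (begin
  Y * Y * suc (suc a + suc a) * (suc a * suc a)
    ≡⟨ regroup Y (suc (suc a + suc a)) (suc a) ⟩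
  (Y * suc a) * (Y * suc a) * suc (suc a + suc a)
    ≡⟨ cong₂ (λ u v → u * u * v) (central-C-suc a) (cong (suc ∘ suc) (+-suc a a)) ⟩
  (2 * suc (a + a) * X) * (2 * suc (a + a) * X) * suc (suc (suc (a + a)))
    ≡⟨ regroup′ (suc (a + a)) X (suc (suc (suc (a + a)))) ⟩
  4 * (X * X * suc (a + a)) * (suc (a + a) * suc (suc (suc (a + a))))
    ≤⟨ *-monoʳ-≤ (4 * (X * X * suc (a + a))) (n≤1+n _) ⟩
  4 * (X * X * suc (a + a)) * suc (suc (a + a) * suc (suc (suc (a + a))))
    ≡⟨ cong (4 * (X * X * suc (a + a)) *_) (square a) ⟩
  4 * (X * X * suc (a + a)) * (4 * (suc a * suc a))
    ≤⟨ *-monoˡ-≤ (4 * (suc a * suc a)) (*-monoʳ-≤ 4 (central-C-bound a)) ⟩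
  4 * 16 ^ a * (4 * (suc a * suc a))
    ≡⟨ regroup″ (16 ^ a) (suc a * suc a) ⟩
  16 * 16 ^ a * (suc a * suc a) ∎)
  where
  open ≤-Reasoning
  X = central-C a
  Y = central-C (suc a)
  regroup : ∀ y s b → y * y * s * (b * b) ≡ (y * b) * (y * b) * s
  regroup = solve-∀
  regroup′ : ∀ s x t → (2 * s * x) * (2 * s * x) * t ≡ 4 * (x * x * s) * (s * t)
  regroup′ = solve-∀
  regroup″ : ∀ p q → 4 * p * (4 * q) ≡ 16 * p * q
  regroup″ = solve-∀
  square : ∀ a → suc ((1 + (a + a)) * (3 + (a + a))) ≡ 4 * ((1 + a) * (1 + a))
  square = solve-∀

-- In the symmetric chain decomposition of the cube {0,1}^m obtained by de Bruijn's doubling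
-- (a chain with ℓ elements yields chains with ℓ + 1 and ℓ - 1 elements in {0,1}^(m+1)),
-- longChains m t is the number of chains with more than t elements.
longChains : ℕ → ℕ → ℕ
longChains zero    zero    = 1
longChains zero    (suc t) = 0
longChains (suc m) t       = longChains m (pred t) + longChains m (suc t)

longChains-vanish : ∀ {m t} → m < t → longChains m t ≡ 0
longChains-vanish {zero}  {suc t} _         = refl
longChains-vanish {suc m} {suc t} (s≤s m<t)
  rewrite longChains-vanish m<t | longChains-vanish (m<n⇒m<1+n (m<n⇒m<1+n m<t)) = refl

longChains-bound : ∀ m t → longChains m t ≤ m C ⌊ m ∸ t /2⌋
longChains-bound zero          zero    = ≤-refl
longChains-bound zero          (suc t) = z≤n
longChains-bound (suc zero)    zero    = ≤-refl
longChains-bound (suc (suc m)) zero    = begin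
  longChains (suc m) 0 + longChains (suc m) 1
    ≤⟨ +-mono-≤ (longChains-bound (suc m) 0) (longChains-bound (suc m) 1) ⟩
  (suc m C ⌊ suc m /2⌋) + (suc m C ⌊ m /2⌋)
    ≡⟨ cong (_+ (suc m C ⌊ m /2⌋)) (C-middle-sym (suc m)) ⟩
  (suc m C suc ⌊ m /2⌋) + (suc m C ⌊ m /2⌋)
    ≡⟨ +-comm (suc m C suc ⌊ m /2⌋) _ ⟩
  (suc m C ⌊ m /2⌋) + (suc m C suc ⌊ m /2⌋)
    ≡⟨ nCk+nC[k+1]≡[n+1]C[k+1] (suc m) ⌊ m /2⌋ ⟩
  suc (suc m) C suc ⌊ m /2⌋ ∎
  where open ≤-Reasoning
longChains-bound (suc m) (suc t) with suc (suc t) ≤? m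
... | yes 2+t≤m = begin
  longChains m t + longChains m (suc (suc t))
    ≤⟨ +-mono-≤ (longChains-bound m t) (longChains-bound m (suc (suc t))) ⟩
  (m C ⌊ m ∸ t /2⌋) + (m C ⌊ d /2⌋)
    ≡⟨ cong (λ e → (m C ⌊ e /2⌋) + (m C ⌊ d /2⌋)) (m∸n≡2+[m∸[2+n]] m t 2+t≤m) ⟩
  (m C suc ⌊ d /2⌋) + (m C ⌊ d /2⌋)
    ≡⟨ +-comm (m C suc ⌊ d /2⌋) _ ⟩
  (m C ⌊ d /2⌋) + (m C suc ⌊ d /2⌋)
    ≡⟨ nCk+nC[k+1]≡[n+1]C[k+1] m ⌊ d /2⌋ ⟩
  suc m C suc ⌊ d /2⌋
    ≡⟨ cong (λ e → suc m C ⌊ e /2⌋) (m∸n≡2+[m∸[2+n]] m t 2+t≤m) ⟨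
  suc m C ⌊ m ∸ t /2⌋ ∎
  where
  open ≤-Reasoning
  d = m ∸ suc (suc t)
  m∸n≡2+[m∸[2+n]] : ∀ m n → suc (suc n) ≤ m → m ∸ n ≡ suc (suc (m ∸ suc (suc n)))
  m∸n≡2+[m∸[2+n]] (suc (suc m)) zero    _         = refl
  m∸n≡2+[m∸[2+n]] (suc m)       (suc n) (s≤s 2+n≤m) = m∸n≡2+[m∸[2+n]] m n 2+n≤m
... | no 2+t≰m rewrite longChains-vanish (≰⇒> 2+t≰m) | +-identityʳ (longChains m t) =
  ≤-trans (longChains-bound m t) (C-mono m ⌊ m ∸ t /2⌋)

longChains-central : ∀ a → longChains (a + a) 0 ≤ central-C a
longChains-central a =
  subst (λ k → longChains (a + a) 0 ≤ (a + a) C k) (sym (n≡⌊n+n/2⌋ a)) (longChains-bound (a + a) 0)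

-- As (2a choose a)² (2a + 1) ≤ 16^a, longChains m 0 is at most 2^m / √(m + 1), so the factor Z
-- is swallowed once m = 4Z².
longChains-sparse : ∀ Z → 2 * Z * longChains (4 * (Z * Z)) 0 < 2 ^ (4 * (Z * Z))
longChains-sparse Z = ≰⇒> (λ 2^m≤ → <-irrefl (sym 4Z²≡a+a) (2a<4Z² 2^m≤))
  where
  a = 2 * (Z * Z)
  c = central-C a
  4Z²≡a+a : 4 * (Z * Z) ≡ a + a
  4Z²≡a+a = 4w≡2w+2w (Z * Z)
    where
    4w≡2w+2w : ∀ w → 4 * w ≡ 2 * w + 2 * w
    4w≡2w+2w = solve-∀
  2a<4Z² : 2 ^ (4 * (Z * Z)) ≤ 2 * Z * longChains (4 * (Z * Z)) 0 → a + a < 4 * (Z * Z)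
  2a<4Z² 2^m≤ = *-cancelˡ-≤ (16 ^ a) {{m^n≢0 16 a}} (begin
    16 ^ a * suc (a + a)
      ≤⟨ *-monoˡ-≤ (suc (a + a)) 16^a≤ ⟩
    (2 * Z * c) * (2 * Z * c) * suc (a + a)
      ≡⟨ regroup Z c (suc (a + a)) ⟩
    4 * (Z * Z) * (c * c * suc (a + a))
      ≤⟨ *-monoʳ-≤ (4 * (Z * Z)) (central-C-bound a) ⟩
    4 * (Z * Z) * 16 ^ a
      ≡⟨ *-comm (4 * (Z * Z)) (16 ^ a) ⟩
    16 ^ a * (4 * (Z * Z)) ∎)
    where
    open ≤-Reasoning
    regroup : ∀ Z c t → (2 * Z * c) * (2 * Z * c) * t ≡ 4 * (Z * Z) * (c * c * t)
    regroup = solve-∀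
    2^[a+a]≤ : 2 ^ (a + a) ≤ 2 * Z * c
    2^[a+a]≤ = subst (λ m → 2 ^ m ≤ 2 * Z * c) 4Z²≡a+a
      (≤-trans 2^m≤ (*-monoʳ-≤ (2 * Z) (subst (λ m → longChains m 0 ≤ c) (sym 4Z²≡a+a) (longChains-central a))))
    16^a≤ : 16 ^ a ≤ (2 * Z * c) * (2 * Z * c)
    16^a≤ = subst (_≤ (2 * Z * c) * (2 * Z * c)) 2^[a+a]² (*-mono-≤ 2^[a+a]≤ 2^[a+a]≤)
      where
      2^[a+a]² : 2 ^ (a + a) * 2 ^ (a + a) ≡ 16 ^ a
      2^[a+a]² = trans (sym (^-distribˡ-+-* 2 (a + a) (a + a)))
                       (trans (cong (2 ^_) (4a a)) (sym (^-*-assoc 2 4 a)))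
        where
        4a : ∀ a → a + a + (a + a) ≡ 4 * a
        4a = solve-∀

toℚᵘ-ℤ→ℚ : ∀ z → toℚᵘ (ℤ→ℚ z) ℚᵘ.≃ mkℚᵘ z 0
toℚᵘ-ℤ→ℚ z = ℚP.toℚᵘ-fromℚᵘ (mkℚᵘ z 0)

ℤ→ℚ-homo-+ : ∀ x y → ℤ→ℚ (x ℤ.+ y) ≡ ℤ→ℚ x ℚ.+ ℤ→ℚ y
ℤ→ℚ-homo-+ x y = ℚP.toℚᵘ-injective (ℚᵘP.≃-trans (toℚᵘ-ℤ→ℚ (x ℤ.+ y)) (ℚᵘP.≃-trans eq
  (ℚᵘP.≃-sym (ℚᵘP.≃-trans (ℚP.toℚᵘ-homo-+ (ℤ→ℚ x) (ℤ→ℚ y)) (ℚᵘP.+-cong (toℚᵘ-ℤ→ℚ x) (toℚᵘ-ℤ→ℚ y))))))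
  where
  eq : mkℚᵘ (x ℤ.+ y) 0 ℚᵘ.≃ mkℚᵘ x 0 ℚᵘ.+ mkℚᵘ y 0
  eq = *≡* (cong (ℤ._* 1ℤ) (sym (cong₂ ℤ._+_ (ℤP.*-identityʳ x) (ℤP.*-identityʳ y))))

ℤ→ℚ-homo-* : ∀ x y → ℤ→ℚ (x ℤ.* y) ≡ ℤ→ℚ x ℚ.* ℤ→ℚ y
ℤ→ℚ-homo-* x y = ℚP.toℚᵘ-injective (ℚᵘP.≃-trans (toℚᵘ-ℤ→ℚ (x ℤ.* y)) (ℚᵘP.≃-trans (*≡* refl)
  (ℚᵘP.≃-sym (ℚᵘP.≃-trans (ℚP.toℚᵘ-homo-* (ℤ→ℚ x) (ℤ→ℚ y)) (ℚᵘP.*-cong (toℚᵘ-ℤ→ℚ x) (toℚᵘ-ℤ→ℚ y))))))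

ℤ→ℚ-homo‿- : ∀ x → ℤ→ℚ (ℤ.- x) ≡ ℚ.- ℤ→ℚ x
ℤ→ℚ-homo‿- x = ℚP.toℚᵘ-injective (ℚᵘP.≃-trans (toℚᵘ-ℤ→ℚ (ℤ.- x))
  (ℚᵘP.≃-sym (ℚᵘP.≃-trans (ℚP.toℚᵘ-homo‿- (ℤ→ℚ x)) (ℚᵘP.-‿cong (toℚᵘ-ℤ→ℚ x)))))

ℤ→ℚ≡mkℚ : ∀ z → ℤ→ℚ z ≡ mkℚ z 0 (Coprimality.sym (Coprimality.1-coprimeTo ℤ.∣ z ∣))
ℤ→ℚ≡mkℚ z = ℚP.fromℚᵘ-toℚᵘ (mkℚ z 0 (Coprimality.sym (Coprimality.1-coprimeTo ℤ.∣ z ∣)))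

ℤ→ℚ-mono-≤ : ∀ {x y} → x ℤ.≤ y → ℤ→ℚ x ℚ.≤ ℤ→ℚ y
ℤ→ℚ-mono-≤ {x} {y} x≤y rewrite ℤ→ℚ≡mkℚ x | ℤ→ℚ≡mkℚ y = ℚ.*≤* (ℤP.*-monoʳ-≤-nonNeg 1ℤ x≤y)

0≤ℤ→ℚ[1+n] : ∀ n → 0ℚ ℚ.≤ ℤ→ℚ +[1+ n ]
0≤ℤ→ℚ[1+n] n = ℤ→ℚ-mono-≤ {0ℤ} {+[1+ n ]} (ℤ.+≤+ z≤n)

1≤ℤ→ℚ[1+n] : ∀ n → 1ℚ ℚ.≤ ℤ→ℚ +[1+ n ]
1≤ℤ→ℚ[1+n] n = ℤ→ℚ-mono-≤ {1ℤ} {+[1+ n ]} (ℤ.+≤+ (s≤s z≤n))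

1≤∣ℤ→ℚ∣ : ∀ z → z ≢ 0ℤ → 1ℚ ℚ.≤ ℚ.∣ ℤ→ℚ z ∣
1≤∣ℤ→ℚ∣ (ℤ.+ zero)   z≢0 = ⊥-elim (z≢0 refl)
1≤∣ℤ→ℚ∣ (+[1+ n ]) _   = subst (1ℚ ℚ.≤_) (sym (ℚP.0≤p⇒∣p∣≡p (0≤ℤ→ℚ[1+n] n))) (1≤ℤ→ℚ[1+n] n)
1≤∣ℤ→ℚ∣ -[1+ n ]   _   = subst (1ℚ ℚ.≤_) ∣1+n∣≡∣-[1+n]∣ (1≤ℤ→ℚ[1+n] n)
  where
  open ≡-Reasoning
  ∣1+n∣≡∣-[1+n]∣ : ℤ→ℚ +[1+ n ] ≡ ℚ.∣ ℤ→ℚ -[1+ n ] ∣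
  ∣1+n∣≡∣-[1+n]∣ = begin
    ℤ→ℚ +[1+ n ]              ≡⟨ ℚP.0≤p⇒∣p∣≡p (0≤ℤ→ℚ[1+n] n) ⟨
    ℚ.∣ ℤ→ℚ (ℤ.- -[1+ n ]) ∣  ≡⟨ cong ℚ.∣_∣ (ℤ→ℚ-homo‿- -[1+ n ]) ⟩
    ℚ.∣ ℚ.- ℤ→ℚ -[1+ n ] ∣    ≡⟨ ℚP.∣-p∣≡∣p∣ (ℤ→ℚ -[1+ n ]) ⟩
    ℚ.∣ ℤ→ℚ -[1+ n ] ∣        ∎

dotℚ-zeroˡ : ∀ {N} (x : Vec ℚ N) → dotℚ (Vec.replicate N 0ℤ) x ≡ 0ℚ
dotℚ-zeroˡ Vec.[]       = refl
dotℚ-zeroˡ (x Vec.∷ xs) rewrite dotℚ-zeroˡ xs = trans (ℚP.+-identityʳ (0ℚ ℚ.* x)) (ℚP.*-zeroˡ x)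

dotℚ-negˡ : ∀ {N} (a : Vec ℤ N) (x : Vec ℚ N) → dotℚ (Vec.map ℤ.-_ a) x ≡ ℚ.- dotℚ a x
dotℚ-negˡ Vec.[]       Vec.[]       = refl
dotℚ-negˡ (a Vec.∷ as) (x Vec.∷ xs) rewrite dotℚ-negˡ as xs | ℤ→ℚ-homo‿- a =
  trans (cong (ℚ._+ ℚ.- dotℚ as xs) (sym (ℚP.neg-distribˡ-* (ℤ→ℚ a) x)))
        (sym (ℚP.neg-distrib-+ (ℤ→ℚ a ℚ.* x) (dotℚ as xs)))

minimum : List ℚ → ℚ
minimum = foldr ℚ._⊓_ 1ℚ

minimum≤ : ∀ xs → All (minimum xs ℚ.≤_) xs
minimum≤ []       = []
minimum≤ (x ∷ xs) = ℚP.p⊓q≤p x (minimum xs) ∷ All.map (ℚP.≤-trans (ℚP.p⊓q≤q x (minimum xs))) (minimum≤ xs)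

0<minimum : ∀ {xs} → All (0ℚ ℚ.<_) xs → 0ℚ ℚ.< minimum xs
0<minimum []                 = ℚP.positive⁻¹ 1ℚ
0<minimum {x ∷ xs} (0<x ∷ 0<xs) with ℚP.⊓-sel x (minimum xs)
... | inj₁ x⊓m≡x = subst (0ℚ ℚ.<_) (sym x⊓m≡x) 0<x
... | inj₂ x⊓m≡m = subst (0ℚ ℚ.<_) (sym x⊓m≡m) (0<minimum 0<xs)

0<∣p-q∣ : ∀ {p q} → p ≢ q → 0ℚ ℚ.< ℚ.∣ p ℚ.- q ∣
0<∣p-q∣ {p} {q} p≢q with ℚP.<-cmp 0ℚ ℚ.∣ p ℚ.- q ∣
... | tri< 0<∣p-q∣ _ _ = 0<∣p-q∣
... | tri≈ _ 0≡∣p-q∣ _ = ⊥-elim (p≢q (begin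
  p                 ≡⟨ solve 2 (λ p q → p := (p :- q) :+ q) refl p q ⟩
  (p ℚ.- q) ℚ.+ q   ≡⟨ cong (ℚ._+ q) (ℚP.∣p∣≡0⇒p≡0 (p ℚ.- q) (sym 0≡∣p-q∣)) ⟩
  0ℚ ℚ.+ q          ≡⟨ ℚP.+-identityˡ q ⟩
  q                 ∎))
  where
  open ≡-Reasoning
  open ℚ-Solver
... | tri> _ _ ∣p-q∣<0 = ⊥-elim (ℚP.<-irrefl refl (ℚP.<-≤-trans ∣p-q∣<0 (ℚP.0≤∣p∣ (p ℚ.- q))))

·≡ℤ→ℚ* : ∀ j δ → j · δ ≡ ℤ→ℚ (ℤ.+ j) ℚ.* δ
·≡ℤ→ℚ* zero    δ = sym (ℚP.*-zeroˡ δ)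
·≡ℤ→ℚ* (suc j) δ = begin
  δ ℚ.+ j · δ                          ≡⟨ cong (δ ℚ.+_) (·≡ℤ→ℚ* j δ) ⟩
  δ ℚ.+ ℤ→ℚ (ℤ.+ j) ℚ.* δ              ≡⟨ solve 2 (λ δ J → δ :+ J :* δ := (con 1ℚ :+ J) :* δ) refl δ (ℤ→ℚ (ℤ.+ j)) ⟩
  (1ℚ ℚ.+ ℤ→ℚ (ℤ.+ j)) ℚ.* δ           ≡⟨ cong (ℚ._* δ) (ℤ→ℚ-homo-+ 1ℤ (ℤ.+ j)) ⟨
  ℤ→ℚ (ℤ.+ suc j) ℚ.* δ                ∎
  where
  open ≡-Reasoning
  open ℚ-Solver

archimedean : ∀ δ → 0ℚ ℚ.< δ → ∃ λ L → 1ℚ ℚ.≤ suc L · δ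
archimedean δ@(mkℚ +[1+ n ] d-1 _) _ =
  d-1 , subst (1ℚ ℚ.≤_) (sym (trans (·≡ℤ→ℚ* (suc d-1) δ) [1+d-1]δ≡1+n)) (1≤ℤ→ℚ[1+n] n)
  where
  [1+d-1]δ≡1+n : ℤ→ℚ (ℤ.+ suc d-1) ℚ.* δ ≡ ℤ→ℚ +[1+ n ]
  [1+d-1]δ≡1+n = ℚP.toℚᵘ-injective (ℚᵘP.≃-trans (ℚP.toℚᵘ-homo-* (ℤ→ℚ (ℤ.+ suc d-1)) δ)
    (ℚᵘP.≃-trans (ℚᵘP.*-congʳ (toℚᵘ-ℤ→ℚ (ℤ.+ suc d-1))) (ℚᵘP.≃-trans (*≡* cross) (ℚᵘP.≃-sym (toℚᵘ-ℤ→ℚ +[1+ n ])))))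
    where
    cross : (ℤ.+ suc d-1 ℤ.* +[1+ n ]) ℤ.* 1ℤ ≡ +[1+ n ] ℤ.* (1ℤ ℤ.* ℤ.+ suc d-1)
    cross = trans (ℤP.*-identityʳ _) (trans (ℤP.*-comm (ℤ.+ suc d-1) +[1+ n ]) (cong (+[1+ n ] ℤ.*_) (sym (ℤP.*-identityˡ (ℤ.+ suc d-1)))))
archimedean (mkℚ (ℤ.+ zero) _ _) (ℚ.*<* (ℤ.+<+ ()))
archimedean (mkℚ -[1+ _ ]   _ _) (ℚ.*<* ())

∣p-q∣≤∣zp-zq∣ : ∀ z → z ≢ 0ℤ → ∀ p q → ℚ.∣ p ℚ.- q ∣ ℚ.≤ ℚ.∣ ℤ→ℚ z ℚ.* p ℚ.- ℤ→ℚ z ℚ.* q ∣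
∣p-q∣≤∣zp-zq∣ z z≢0 p q = begin
  ℚ.∣ p ℚ.- q ∣                  ≡⟨ ℚP.*-identityˡ _ ⟨
  1ℚ ℚ.* ℚ.∣ p ℚ.- q ∣           ≤⟨ ℚP.*-monoʳ-≤-nonNeg ℚ.∣ p ℚ.- q ∣ {{ℚ.nonNegative (ℚP.0≤∣p∣ (p ℚ.- q))}} (1≤∣ℤ→ℚ∣ z z≢0) ⟩
  ℚ.∣ Z ∣ ℚ.* ℚ.∣ p ℚ.- q ∣       ≡⟨ ℚP.∣p*q∣≡∣p∣*∣q∣ Z (p ℚ.- q) ⟨
  ℚ.∣ Z ℚ.* (p ℚ.- q) ∣           ≡⟨ cong ℚ.∣_∣ (solve 3 (λ Z p q → Z :* (p :- q) := Z :* p :- Z :* q) refl Z p q) ⟩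
  ℚ.∣ Z ℚ.* p ℚ.- Z ℚ.* q ∣       ∎
  where
  open ℚP.≤-Reasoning
  open ℚ-Solver
  Z = ℤ→ℚ z

complement : ∀ {N} → Ineq N → Ineq N
complement (ineq a b) = ineq (Vec.map ℤ.-_ a) (1ℤ ℤ.- b)

queries : ∀ {N} → SPTree N → List (Ineq N)
queries leaf            = []
queries (query a b t u) = ineq a b ∷ queries t ++ queries u

length-queries : ∀ {N} (τ : SPTree N) → length (queries τ) ≡ spLength τ
length-queries leaf            = refl
length-queries (query a b t u) = cong suc (trans (List.length-++ (queries t)) (cong₂ _+_ (length-queries t) (length-queries u)))

outsideIfZero : ∀ {z} → Dec (z ≡ 0ℤ) → Bool
outsideIfZero (yes _) = outside
outsideIfZero (no  _) = inside

support : ∀ {N} → Vec ℤ N → Subset N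
support = Vec.map (λ z → outsideIfZero (z ℤ.≟ 0ℤ))

weight : ∀ {N} → Vec ℤ N → ℕ
weight a = ∣ support a ∣

∈-support : ∀ {N} (a : Vec ℤ N) i → lookup a i ≢ 0ℤ → i ∈ support a
∈-support a i aᵢ≢0 with lookup a i ℤ.≟ 0ℤ in eq
... | yes aᵢ≡0 = ⊥-elim (aᵢ≢0 aᵢ≡0)
... | no  _    = Vec.lookup⇒[]= i (support a) (trans (Vec.lookup-map i _ a) (cong outsideIfZero eq))

zeros : ∀ N → Vec ℤ N
zeros N = Vec.replicate N 0ℤ

tabulate-zeros : ∀ {N} (f : Fin N → ℤ) → (∀ i → f i ≡ 0ℤ) → tabulate f ≡ zeros N
tabulate-zeros {zero}  f f≡0 = refl
tabulate-zeros {suc N} f f≡0 = cong₂ Vec._∷_ (f≡0 Fin.zero) (tabulate-zeros (f ∘ Fin.suc) (f≡0 ∘ Fin.suc))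

nonzero : ∀ {N} → Ineq N → Bool
nonzero I = not (does (Vec.≡-dec ℤ._≟_ (coeffs I) (zeros _)))

¬nonzero : ∀ {N} (I : Ineq N) → coeffs I ≡ zeros N → ¬ T (nonzero I)
¬nonzero I a≡0 = subst (T ∘ not) (dec-true (Vec.≡-dec ℤ._≟_ (coeffs I) (zeros _)) a≡0)

short : ℕ → ∀ {N} → Ineq N → Bool
short m I = nonzero I ∧ (weight (coeffs I) <ᵇ m)

short-elim : ∀ m {N} (I : Ineq N) → T (short m I) → T (nonzero I) × weight (coeffs I) < m
short-elim m I short-I with Equivalence.to (T-∧ {nonzero I}) short-I
... | nonzero-I , w<m = nonzero-I , <ᵇ⇒< (weight (coeffs I)) m w<m

¬short : ∀ {m N} (I : Ineq N) → ¬ T (short m I) → coeffs I ≡ zeros N ⊎ m ≤ weight (coeffs I)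
¬short {m} {N} I not-short with Vec.≡-dec ℤ._≟_ (coeffs I) (zeros N)
... | yes a≡0 = inj₁ a≡0
... | no  _   with weight (coeffs I) <? m
...   | yes w<m = ⊥-elim (not-short (Equivalence.from T-∧ (tt , <⇒<ᵇ w<m)))
...   | no  w≮m = inj₂ (≮⇒≥ w≮m)

-- Littlewood–Offord anticoncentration over the alphabet W

shift : ℚ → List ℚ → List ℚ
shift s = map (s ℚ.+_)

long : ℕ → List ℚ → Bool
long t C = t <ᵇ length C

count-long-shift : ∀ t s cs → count (long t) (map (shift s) cs) ≡ count (long t) cs
count-long-shift t s cs =
  trans (count-map (long t) (shift s) cs) (count-cong (λ C → cong (t <ᵇ_) (List.length-map (s ℚ.+_) C)) cs)

Narrow : (ℚ → Bool) → Set
Narrow P = ∀ d e → T (P d) → T (P e) → e ℚ.< d ℚ.+ 1ℚ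

module Anticoncentration (W : List ℚ) (δ : ℚ) (0≤δ : 0ℚ ℚ.≤ δ)
                         (δ≤gap : All (λ (u , v) → δ ℚ.≤ ℚ.∣ u ℚ.- v ∣) (cyclicPairs W)) where

  k : ℕ
  k = length W

  infix 4 _≺_
  _≺_ : ℚ → ℚ → Set
  x ≺ y = x ℚ.+ δ ℚ.≤ y

  x≤x+δ : ∀ x → x ℚ.≤ x ℚ.+ δ
  x≤x+δ x = subst (ℚ._≤ x ℚ.+ δ) (ℚP.+-identityʳ x) (ℚP.+-monoʳ-≤ x 0≤δ)

  ≺-trans : Transitive _≺_
  ≺-trans {x} {y} x≺y y≺z = ℚP.≤-trans (ℚP.≤-trans x≺y (x≤x+δ y)) y≺z

  ≺-shift : ∀ s {x y} → x ≺ y → s ℚ.+ x ≺ s ℚ.+ y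
  ≺-shift s {x} x≺y = subst (ℚ._≤ _) (sym (ℚP.+-assoc s x δ)) (ℚP.+-monoʳ-≤ s x≺y)

  Separated : List ℚ → Set
  Separated = Linked _≺_

  separated-shift : ∀ s {C} → Separated C → Separated (shift s C)
  separated-shift s []          = []
  separated-shift s [-]         = [-]
  separated-shift s (x≺y ∷ sep) = ≺-shift s x≺y ∷ separated-shift s sep

  separated-head : ∀ {d D} → Separated (d ∷ D) → All (d ≺_) D
  separated-head [-]         = []
  separated-head {d} (d≺y ∷ sep) = d≺y ∷ All.map (≺-trans {d} d≺y) (separated-head sep)

  ordered : ∀ p q → δ ℚ.≤ ℚ.∣ p ℚ.- q ∣ → ¬ (q ≺ p) → p ≺ q
  ordered p q δ≤∣p-q∣ q⊀p with ℚP.∣p∣≡p∨∣p∣≡-p (p ℚ.- q)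
  ... | inj₁ ∣p-q∣≡p-q = ⊥-elim (q⊀p (subst (q ℚ.+ δ ℚ.≤_) (solve 2 (λ p q → q :+ (p :- q) := p) refl p q)
                                        (ℚP.+-monoʳ-≤ q (subst (δ ℚ.≤_) ∣p-q∣≡p-q δ≤∣p-q∣))))
    where open ℚ-Solver
  ... | inj₂ ∣p-q∣≡q-p = subst (p ℚ.+ δ ℚ.≤_) (solve 2 (λ p q → p :+ (:- (p :- q)) := q) refl p q)
                           (ℚP.+-monoʳ-≤ p (subst (δ ℚ.≤_) ∣p-q∣≡q-p δ≤∣p-q∣))
    where open ℚ-Solver

  values : ∀ {N} → Vec ℤ N → List ℚ
  values {N} a = map (dotℚ a) (words W N)

  count-values-∷ : ∀ {N} a₀ (a : Vec ℤ N) P →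
    count P (values (a₀ Vec.∷ a)) ≡ sum (map (λ w → count (P ∘ (ℤ→ℚ a₀ ℚ.* w ℚ.+_)) (values a)) W)
  count-values-∷ {N} a₀ a P = begin
    count P (map (dotℚ (a₀ Vec.∷ a)) (concatMap (λ w → map (w Vec.∷_) (words W N)) W))
      ≡⟨ count-map P (dotℚ (a₀ Vec.∷ a)) (concatMap (λ w → map (w Vec.∷_) (words W N)) W) ⟩
    count (P ∘ dotℚ (a₀ Vec.∷ a)) (concatMap (λ w → map (w Vec.∷_) (words W N)) W)
      ≡⟨ sum-map-concatMap (indicator ∘ P ∘ dotℚ (a₀ Vec.∷ a)) (λ w → map (w Vec.∷_) (words W N)) W ⟩
    sum (map (λ w → count (P ∘ dotℚ (a₀ Vec.∷ a)) (map (w Vec.∷_) (words W N))) W)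
      ≡⟨ cong sum (List.map-cong (λ w → trans (count-map _ (w Vec.∷_) (words W N))
                                              (sym (count-map _ (dotℚ a) (words W N)))) W) ⟩
    sum (map (λ w → count (P ∘ (ℤ→ℚ a₀ ℚ.* w ℚ.+_)) (values a)) W) ∎
    where open ≡-Reasoning

  -- Kleitman's step: when lo ≺ hi, moving the bottom element of lo + C onto the chain hi + C
  -- keeps both chains separated, and changes their lengths to |C| + 1 and |C| - 1.
  kleitman : ℚ → ℚ → List ℚ → List (List ℚ)
  kleitman lo hi []      = []
  kleitman lo hi (e ∷ C) = (lo ℚ.+ e ∷ shift hi (e ∷ C)) ∷ shift lo C ∷ []

  kleitman-count : ∀ P lo hi C → sum (map (count P) (kleitman lo hi C)) ≡ count P (shift lo C) + count P (shift hi C)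
  kleitman-count P lo hi []      = refl
  kleitman-count P lo hi (e ∷ C) =
    rearrange (indicator (P (lo ℚ.+ e))) (count P (shift hi (e ∷ C))) (count P (shift lo C))
    where
    rearrange : ∀ b x y → b + x + (y + 0) ≡ b + y + x
    rearrange = solve-∀

  kleitman-long : ∀ t lo hi C → count (long t) (kleitman lo hi C) ≡ indicator (long (pred t) C) + indicator (long (suc t) C)
  kleitman-long t lo hi []      = refl
  kleitman-long t lo hi (e ∷ C) = lengths t (List.length-map (hi ℚ.+_) C) (List.length-map (lo ℚ.+_) C)
    where
    lengths : ∀ t {n₁ n₂ n} → n₁ ≡ n → n₂ ≡ n →
              indicator (t <ᵇ suc (suc n₁)) + (indicator (t <ᵇ n₂) + 0) ≡ indicator (pred t <ᵇ suc n) + indicator (suc t <ᵇ suc n)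
    lengths zero    refl refl = cong suc (+-identityʳ _)
    lengths (suc t) {n = n} refl refl = cong (indicator (t <ᵇ suc n) +_) (+-identityʳ _)

  kleitman-separated : ∀ {lo hi} → lo ≺ hi → ∀ {C} → Separated C → All Separated (kleitman lo hi C)
  kleitman-separated lo≺hi {[]}    _   = []
  kleitman-separated {lo} {hi} lo≺hi {e ∷ C} sep =
    (lo+e≺hi+e ∷ separated-shift hi sep) ∷ separated-shift lo (Linked.tail sep) ∷ []
    where
    lo+e≺hi+e : lo ℚ.+ e ≺ hi ℚ.+ e
    lo+e≺hi+e = subst (ℚ._≤ hi ℚ.+ e) (solve 3 (λ lo δ e → (lo :+ δ) :+ e := (lo :+ e) :+ δ) refl lo δ e) (ℚP.+-monoˡ-≤ e lo≺hi)
      where open ℚ-Solver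

  splitChain : ℚ → ℚ → List ℚ → List (List ℚ)
  splitChain p q with q ℚ.+ δ ℚP.≤? p
  ... | yes _ = kleitman q p
  ... | no  _ = kleitman p q

  splitChain-count : ∀ P p q C → sum (map (count P) (splitChain p q C)) ≡ count P (shift p C) + count P (shift q C)
  splitChain-count P p q C with q ℚ.+ δ ℚP.≤? p
  ... | yes _ = trans (kleitman-count P q p C) (+-comm (count P (shift q C)) _)
  ... | no  _ = kleitman-count P p q C

  splitChain-long : ∀ t p q C → count (long t) (splitChain p q C) ≡ indicator (long (pred t) C) + indicator (long (suc t) C)
  splitChain-long t p q C with q ℚ.+ δ ℚP.≤? p
  ... | yes _ = kleitman-long t q p C
  ... | no  _ = kleitman-long t p q C

  splitChain-separated : ∀ {p q} → δ ℚ.≤ ℚ.∣ p ℚ.- q ∣ → ∀ {C} → Separated C → All Separated (splitChain p q C)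
  splitChain-separated {p} {q} δ≤∣p-q∣ with q ℚ.+ δ ℚP.≤? p
  ... | yes q≺p = kleitman-separated q≺p
  ... | no  q⊀p = kleitman-separated (ordered p q δ≤∣p-q∣ q⊀p)

  shiftAll : ℤ → List (List ℚ) → List (List ℚ)
  shiftAll z cs = concatMap (λ w → map (shift (ℤ→ℚ z ℚ.* w)) cs) W

  count-shiftAll : ∀ P z cs → sum (map (count P) (shiftAll z cs)) ≡ sum (map (λ w → sum (map (count P ∘ shift (ℤ→ℚ z ℚ.* w)) cs)) W)
  count-shiftAll P z cs = trans (sum-map-concatMap (count P) (λ w → map (shift (ℤ→ℚ z ℚ.* w)) cs) W)
                                (cong sum (List.map-cong (λ w → cong sum (sym (List.map-∘ cs))) W))

  long-shiftAll : ∀ t z cs → count (long t) (shiftAll z cs) ≡ k * count (long t) cs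
  long-shiftAll t z cs = begin
    count (long t) (shiftAll z cs)
      ≡⟨ sum-map-concatMap (indicator ∘ long t) (λ w → map (shift (ℤ→ℚ z ℚ.* w)) cs) W ⟩
    sum (map (λ w → count (long t) (map (shift (ℤ→ℚ z ℚ.* w)) cs)) W)
      ≡⟨ cong sum (List.map-cong (λ w → count-long-shift t (ℤ→ℚ z ℚ.* w) cs) W) ⟩
    sum (map (const (count (long t) cs)) W)
      ≡⟨ sum-map-const _ W ⟩
    k * count (long t) cs ∎
    where open ≡-Reasoning

  separated-shiftAll : ∀ z {cs} → All Separated cs → All Separated (shiftAll z cs)
  separated-shiftAll z separated =
    All.concat⁺ (All.map⁺ {xs = W} (All.tabulate λ {w} _ → All.map⁺ (All.map (separated-shift (ℤ→ℚ z ℚ.* w)) separated)))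

  splitAll : ℤ → List (List ℚ) → List (List ℚ)
  splitAll z cs = concatMap (λ (u , v) → concatMap (splitChain (ℤ→ℚ z ℚ.* u) (ℤ→ℚ z ℚ.* v)) cs) (cyclicPairs W)

  -- Each letter of W occurs in two cyclic pairs, so splitting redistributes two copies of shiftAll.
  count-splitAll : ∀ P z cs → sum (map (count P) (splitAll z cs)) ≡ 2 * sum (map (count P) (shiftAll z cs))
  count-splitAll P z cs = begin
    sum (map (count P) (splitAll z cs))
      ≡⟨ sum-map-concatMap (count P) _ (cyclicPairs W) ⟩
    sum (map (λ (u , v) → sum (map (count P) (concatMap (split u v) cs))) (cyclicPairs W))
      ≡⟨ cong sum (List.map-cong (λ (u , v) → begin
           sum (map (count P) (concatMap (split u v) cs))
             ≡⟨ sum-map-concatMap (count P) (split u v) cs ⟩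
           sum (map (sum ∘ map (count P) ∘ split u v) cs)
             ≡⟨ cong sum (List.map-cong (splitChain-count P (zw u) (zw v)) cs) ⟩
           sum (map (λ C → count P (shift (zw u) C) + count P (shift (zw v) C)) cs)
             ≡⟨ sum-map-+ (count P ∘ shift (zw u)) (count P ∘ shift (zw v)) cs ⟩
           perShift u + perShift v ∎) (cyclicPairs W)) ⟩
    sum (map (λ (u , v) → perShift u + perShift v) (cyclicPairs W))
      ≡⟨ sum-map-cyclicPairs perShift W ⟩
    2 * sum (map perShift W)
      ≡⟨ cong (2 *_) (count-shiftAll P z cs) ⟨
    2 * sum (map (count P) (shiftAll z cs)) ∎
    where
    open ≡-Reasoning
    zw : ℚ → ℚ
    zw w = ℤ→ℚ z ℚ.* w
    split : ℚ → ℚ → List ℚ → List (List ℚ)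
    split u v = splitChain (zw u) (zw v)
    perShift : ℚ → ℕ
    perShift w = sum (map (count P ∘ shift (zw w)) cs)

  long-splitAll : ∀ t z cs → count (long t) (splitAll z cs) ≡ k * (count (long (pred t)) cs + count (long (suc t)) cs)
  long-splitAll t z cs = begin
    count (long t) (splitAll z cs)
      ≡⟨ sum-map-concatMap (indicator ∘ long t) _ (cyclicPairs W) ⟩
    sum (map (λ (u , v) → count (long t) (concatMap (splitChain (zw u) (zw v)) cs)) (cyclicPairs W))
      ≡⟨ cong sum (List.map-cong (λ (u , v) →
           trans (sum-map-concatMap (indicator ∘ long t) (splitChain (zw u) (zw v)) cs)
           (trans (cong sum (List.map-cong (splitChain-long t (zw u) (zw v)) cs))
                  (sum-map-+ (indicator ∘ long (pred t)) (indicator ∘ long (suc t)) cs))) (cyclicPairs W)) ⟩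
    sum (map (const (count (long (pred t)) cs + count (long (suc t)) cs)) (cyclicPairs W))
      ≡⟨ sum-map-const _ (cyclicPairs W) ⟩
    length (cyclicPairs W) * (count (long (pred t)) cs + count (long (suc t)) cs)
      ≡⟨ cong (_* _) (length-cyclicPairs W) ⟩
    k * (count (long (pred t)) cs + count (long (suc t)) cs) ∎
    where
    open ≡-Reasoning
    zw : ℚ → ℚ
    zw w = ℤ→ℚ z ℚ.* w

  separated-splitAll : ∀ z → z ≢ 0ℤ → ∀ {cs} → All Separated cs → All Separated (splitAll z cs)
  separated-splitAll z z≢0 separated = All.concat⁺ (All.map⁺ (All.map (λ {(u , v)} δ≤∣u-v∣ →
    All.concat⁺ (All.map⁺ (All.map (splitChain-separated {ℤ→ℚ z ℚ.* u} {ℤ→ℚ z ℚ.* v} (ℚP.≤-trans δ≤∣u-v∣ (∣p-q∣≤∣zp-zq∣ z z≢0 u v))) separated)))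
    δ≤gap))

  -- 2^m copies of the values a·x (x ∈ W^N), arranged into separated chains; multisets of
  -- rationals are compared through the number of their elements satisfying each Boolean predicate.
  record ChainCover {N} (a : Vec ℤ N) (m : ℕ) : Set where
    field
      chains    : List (List ℚ)
      covers    : ∀ P → 2 ^ m * count P (values a) ≡ sum (map (count P) chains)
      separated : All Separated chains
      few-long  : ∀ t → count (long t) chains ≤ k ^ N * longChains m t
  open ChainCover

  empty-cover : ChainCover Vec.[] 0
  empty-cover = record
    { chains = (0ℚ ∷ []) ∷ [] ; covers = λ _ → refl ; separated = [-] ∷ [] ; few-long = few-long′ }
    where
    few-long′ : ∀ t → count (long t) ((0ℚ ∷ []) ∷ []) ≤ 1 * longChains 0 t
    few-long′ zero    = ≤-refl
    few-long′ (suc t) = z≤n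

  covers-∷ : ∀ {N m} a₀ {a : Vec ℤ N} (I : ChainCover a m) P →
             2 ^ m * count P (values (a₀ Vec.∷ a)) ≡ sum (map (count P) (shiftAll a₀ (chains I)))
  covers-∷ {m = m} a₀ {a} I P = begin
    2 ^ m * count P (values (a₀ Vec.∷ a))
      ≡⟨ cong (2 ^ m *_) (count-values-∷ a₀ a P) ⟩
    2 ^ m * sum (map (λ w → count (P ∘ (zw w ℚ.+_)) (values a)) W)
      ≡⟨ *-distribˡ-sum-map (2 ^ m) _ W ⟩
    sum (map (λ w → 2 ^ m * count (P ∘ (zw w ℚ.+_)) (values a)) W)
      ≡⟨ cong sum (List.map-cong (λ w → trans (covers I (P ∘ (zw w ℚ.+_)))
                                              (cong sum (List.map-cong (sym ∘ count-map P (zw w ℚ.+_)) (chains I)))) W) ⟩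
    sum (map (λ w → sum (map (count P ∘ shift (zw w)) (chains I))) W)
      ≡⟨ count-shiftAll P a₀ (chains I) ⟨
    sum (map (count P) (shiftAll a₀ (chains I))) ∎
    where
    open ≡-Reasoning
    zw : ℚ → ℚ
    zw w = ℤ→ℚ a₀ ℚ.* w

  extend-cover : ∀ {N m} a₀ {a : Vec ℤ N} → ChainCover a m → ChainCover (a₀ Vec.∷ a) m
  extend-cover {N} {m} a₀ I = record
    { chains    = shiftAll a₀ (chains I)
    ; covers    = covers-∷ a₀ I
    ; separated = separated-shiftAll a₀ (separated I)
    ; few-long  = λ t → begin
        count (long t) (shiftAll a₀ (chains I)) ≡⟨ long-shiftAll t a₀ (chains I) ⟩
        k * count (long t) (chains I)           ≤⟨ *-monoʳ-≤ k (few-long I t) ⟩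
        k * (k ^ N * longChains m t)            ≡⟨ *-assoc k (k ^ N) _ ⟨
        k ^ suc N * longChains m t              ∎
    }
    where open ≤-Reasoning

  split-cover : ∀ {N m} a₀ {a : Vec ℤ N} → a₀ ≢ 0ℤ → ChainCover a m → ChainCover (a₀ Vec.∷ a) (suc m)
  split-cover {N} {m} a₀ {a} a₀≢0 I = record
    { chains    = splitAll a₀ (chains I)
    ; covers    = λ P → begin-equality
        2 * 2 ^ m * count P (values (a₀ Vec.∷ a))           ≡⟨ *-assoc 2 (2 ^ m) _ ⟩
        2 * (2 ^ m * count P (values (a₀ Vec.∷ a)))         ≡⟨ cong (2 *_) (covers-∷ a₀ I P) ⟩
        2 * sum (map (count P) (shiftAll a₀ (chains I)))    ≡⟨ count-splitAll P a₀ (chains I) ⟨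
        sum (map (count P) (splitAll a₀ (chains I)))        ∎
    ; separated = separated-splitAll a₀ a₀≢0 (separated I)
    ; few-long  = λ t → begin
        count (long t) (splitAll a₀ (chains I))
          ≡⟨ long-splitAll t a₀ (chains I) ⟩
        k * (count (long (pred t)) (chains I) + count (long (suc t)) (chains I))
          ≤⟨ *-monoʳ-≤ k (+-mono-≤ (few-long I (pred t)) (few-long I (suc t))) ⟩
        k * (k ^ N * longChains m (pred t) + k ^ N * longChains m (suc t))
          ≡⟨ cong (k *_) (*-distribˡ-+ (k ^ N) (longChains m (pred t)) _) ⟨
        k * (k ^ N * longChains (suc m) t)
          ≡⟨ *-assoc k (k ^ N) _ ⟨
        k ^ suc N * longChains (suc m) t ∎
    }
    where open ≤-Reasoning

  chainCover : ∀ {N} (a : Vec ℤ N) m → m ≤ weight a → ChainCover a m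
  chainCover Vec.[]         zero    _   = empty-cover
  chainCover (a₀ Vec.∷ a) zero    _   = extend-cover a₀ (chainCover a zero z≤n)
  chainCover (a₀ Vec.∷ a) (suc m) m<w with a₀ ℤ.≟ 0ℤ
  ... | yes _    = extend-cover a₀ (chainCover a (suc m) m<w)
  ... | no a₀≢0 = split-cover a₀ a₀≢0 (chainCover a m (≤-pred m<w))

  below : ℚ → ℚ → Bool
  below x e = does (e ℚP.<? x)

  count-below-≡0 : ∀ {x D} → All (x ℚ.≤_) D → count (below x) D ≡ 0
  count-below-≡0 []                    = refl
  count-below-≡0 {x} {e ∷ D} (x≤e ∷ x≤D) =
    cong₂ _+_ (cong indicator (dec-false (e ℚP.<? x) (λ e<x → ℚP.<-irrefl refl (ℚP.<-≤-trans e<x x≤e)))) (count-below-≡0 x≤D)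

  count-below-≤ : ∀ j t x {D} → Separated D → All (t ℚ.≤_) D → x ℚ.≤ t ℚ.+ j · δ → count (below x) D ≤ j
  count-below-≤ j t x {[]}    _   _         _  = z≤n
  count-below-≤ j t x {d ∷ D} sep (t≤d ∷ _) x≤ = step j x≤ (d ℚP.<? x)
    where
    step : ∀ j → x ℚ.≤ t ℚ.+ j · δ → (d<?x : Dec (d ℚ.< x)) → indicator (does d<?x) + count (below x) D ≤ j
    step j       _  (no d≮x) = ≤-trans (≤-reflexive (count-below-≡0
      (All.map (λ d≺e → ℚP.≤-trans (ℚP.≮⇒≥ d≮x) (ℚP.≤-trans (x≤x+δ d) d≺e)) (separated-head sep)))) z≤n
    step zero    x≤ (yes d<x) =
      ⊥-elim (ℚP.<-irrefl refl (ℚP.<-≤-trans d<x (ℚP.≤-trans (subst (x ℚ.≤_) (ℚP.+-identityʳ t) x≤) t≤d)))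
    step (suc j) x≤ (yes d<x) = s≤s (count-below-≤ j (d ℚ.+ δ) x (Linked.tail sep) (separated-head sep)
      (ℚP.≤-trans (subst (x ℚ.≤_) (sym (ℚP.+-assoc t δ (j · δ))) x≤) (ℚP.+-monoˡ-≤ (j · δ) (ℚP.+-monoˡ-≤ δ t≤d))))

  module _ (L : ℕ) (1≤[1+L]δ : 1ℚ ℚ.≤ suc L · δ) (P : ℚ → Bool) (narrow : Narrow P) where

    separated-count : ∀ {C} → Separated C → count P C ≤ suc L
    separated-count {[]}    _   = z≤n
    separated-count {d ∷ C} sep with P d in Pd
    ... | false = separated-count (Linked.tail sep)
    ... | true  = s≤s (≤-trans (count-mono {Q = below (d ℚ.+ 1ℚ)} (λ e Pe → T-does (e ℚP.<? d ℚ.+ 1ℚ) (narrow d e (subst T (sym Pd) tt) Pe)) C)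
                                (count-below-≤ L (d ℚ.+ δ) (d ℚ.+ 1ℚ) (Linked.tail sep) (separated-head sep) d+1≤))
      where
      d+1≤ : d ℚ.+ 1ℚ ℚ.≤ d ℚ.+ δ ℚ.+ L · δ
      d+1≤ = subst (d ℚ.+ 1ℚ ℚ.≤_) (sym (ℚP.+-assoc d δ (L · δ))) (ℚP.+-monoʳ-≤ d 1≤[1+L]δ)

    separated-count-long : ∀ {C} → Separated C → count P C ≤ suc L * indicator (long 0 C)
    separated-count-long {[]}    _   = z≤n
    separated-count-long {d ∷ C} sep = subst (count P (d ∷ C) ≤_) (sym (*-identityʳ (suc L))) (separated-count sep)

    anticoncentration : ∀ {N} (a : Vec ℤ N) m → m ≤ weight a → 2 ^ m * count P (values a) ≤ suc L * (k ^ N * longChains m 0)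
    anticoncentration {N} a m m≤w = begin
      2 ^ m * count P (values a)                     ≡⟨ covers I P ⟩
      sum (map (count P) (chains I))                 ≤⟨ sum-map-mono (All.map separated-count-long (separated I)) ⟩
      sum (map ((suc L *_) ∘ indicator ∘ long 0) (chains I)) ≡⟨ *-distribˡ-sum-map (suc L) (indicator ∘ long 0) (chains I) ⟨
      suc L * count (long 0) (chains I)              ≤⟨ *-monoʳ-≤ (suc L) (few-long I 0) ⟩
      suc L * (k ^ N * longChains m 0)               ∎
      where
      open ≤-Reasoning
      I = chainCover a m m≤w

-- Restricting a Stabbing Planes refutation

open CommutativeMonoidSum ℚP.+-0-commutativeMonoid using () renaming (sum to ∑; sum-cong-≗ to ∑-cong; sum-remove to ∑-remove)

∑-reindex : ∀ {N M} (σ : Fin M → Fin N) → Injective _≡_ _≡_ σ → (h : Fin N → ℚ) →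
            (∀ i → (∀ j → σ j ≢ i) → h i ≡ 0ℚ) → ∑ h ≡ ∑ (h ∘ σ)
∑-reindex {zero}  {zero}  σ _ h _ = refl
∑-reindex {zero}  {suc M} σ _ h _ with σ Fin.zero
... | ()
∑-reindex {suc N} {M}     σ σ-inj h h-off with Fin.any? (λ j → σ j Fin.≟ Fin.zero)
... | no 0∉σ = begin
  h Fin.zero ℚ.+ ∑ (h ∘ Fin.suc)  ≡⟨ cong (ℚ._+ ∑ (h ∘ Fin.suc)) (h-off Fin.zero (λ j σj≡0 → 0∉σ (j , σj≡0))) ⟩
  0ℚ ℚ.+ ∑ (h ∘ Fin.suc)          ≡⟨ ℚP.+-identityˡ _ ⟩
  ∑ (h ∘ Fin.suc)                 ≡⟨ ∑-reindex σ′ σ′-inj (h ∘ Fin.suc) h′-off ⟩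
  ∑ (h ∘ Fin.suc ∘ σ′)            ≡⟨ ∑-cong (λ j → cong h (Fin.punchIn-punchOut (0≢σ j))) ⟩
  ∑ (h ∘ σ)                       ∎
  where
  open ≡-Reasoning
  0≢σ : ∀ j → Fin.zero ≢ σ j
  0≢σ j 0≡σj = 0∉σ (j , sym 0≡σj)
  σ′ : Fin M → Fin N
  σ′ j = punchOut (0≢σ j)
  σ′-inj : Injective _≡_ _≡_ σ′
  σ′-inj {x} {y} eq = σ-inj (Fin.punchOut-injective (0≢σ x) (0≢σ y) eq)
  h′-off : ∀ i → (∀ j → σ′ j ≢ i) → h (Fin.suc i) ≡ 0ℚ
  h′-off i i∉σ′ = h-off (Fin.suc i) (λ j σj≡1+i → i∉σ′ j (Fin.suc-injective (trans (Fin.punchIn-punchOut (0≢σ j)) σj≡1+i)))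
∑-reindex {suc N} {suc M} σ σ-inj h h-off | yes (j₀ , σj₀≡0) = begin
  h Fin.zero ℚ.+ ∑ (h ∘ Fin.suc)          ≡⟨ cong₂ ℚ._+_ (cong h (sym σj₀≡0)) (∑-reindex σ′ σ′-inj (h ∘ Fin.suc) h′-off) ⟩
  h (σ j₀) ℚ.+ ∑ (h ∘ Fin.suc ∘ σ′)       ≡⟨ cong (h (σ j₀) ℚ.+_) (∑-cong (λ j → cong h (Fin.punchIn-punchOut (0≢σ j)))) ⟩
  h (σ j₀) ℚ.+ ∑ (h ∘ σ ∘ punchIn j₀)     ≡⟨ ∑-remove {i = j₀} (h ∘ σ) ⟨
  ∑ (h ∘ σ)                               ∎
  where
  open ≡-Reasoning
  0≢σ : ∀ j → Fin.zero ≢ σ (punchIn j₀ j)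
  0≢σ j 0≡σj = Fin.punchInᵢ≢i j₀ j (sym (σ-inj (trans σj₀≡0 0≡σj)))
  σ′ : Fin M → Fin N
  σ′ j = punchOut (0≢σ j)
  σ′-inj : Injective _≡_ _≡_ σ′
  σ′-inj {x} {y} eq = Fin.punchIn-injective j₀ x y (σ-inj (Fin.punchOut-injective (0≢σ x) (0≢σ y) eq))
  h′-off : ∀ i → (∀ j → σ′ j ≢ i) → h (Fin.suc i) ≡ 0ℚ
  h′-off i i∉σ′ = h-off (Fin.suc i) 1+i∉σ
    where
    1+i∉σ : ∀ j → σ j ≢ Fin.suc i
    1+i∉σ j σj≡1+i with j Fin.≟ j₀
    ... | yes refl = Fin.0≢1+n (trans (sym σj₀≡0) σj≡1+i)
    ... | no j≢j₀  = i∉σ′ (punchOut (j≢j₀ ∘ sym)) (Fin.suc-injective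
      (trans (Fin.punchIn-punchOut (0≢σ (punchOut (j≢j₀ ∘ sym)))) (trans (cong σ (Fin.punchIn-punchOut (j≢j₀ ∘ sym))) σj≡1+i)))

dotℚ≡∑ : ∀ {N} (a : Vec ℤ N) (x : Vec ℚ N) → dotℚ a x ≡ ∑ (λ i → ℤ→ℚ (lookup a i) ℚ.* lookup x i)
dotℚ≡∑ Vec.[]       Vec.[]       = refl
dotℚ≡∑ (a Vec.∷ as) (x Vec.∷ xs) = cong (ℤ→ℚ a ℚ.* x ℚ.+_) (dotℚ≡∑ as xs)

ℤ→ℚ-fixedPart : ∀ {N} (a : Vec ℤ N) ρ → ℤ→ℚ (fixedPart a ρ) ≡ ∑ (λ i → ℤ→ℚ (lookup a i) ℚ.* ℤ→ℚ (maybeVal (ρ i)))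
ℤ→ℚ-fixedPart Vec.[]       ρ = refl
ℤ→ℚ-fixedPart (a Vec.∷ as) ρ = trans (ℤ→ℚ-homo-+ (a ℤ.* maybeVal (ρ Fin.zero)) (fixedPart as (ρ ∘ Fin.suc)))
  (cong₂ ℚ._+_ (ℤ→ℚ-homo-* a (maybeVal (ρ Fin.zero))) (ℤ→ℚ-fixedPart as (ρ ∘ Fin.suc)))

fixedPart-neg : ∀ {N} (a : Vec ℤ N) ρ → fixedPart (Vec.map ℤ.-_ a) ρ ≡ ℤ.- fixedPart a ρ
fixedPart-neg Vec.[]       ρ = refl
fixedPart-neg (a Vec.∷ as) ρ rewrite fixedPart-neg as (ρ ∘ Fin.suc) =
  trans (cong (ℤ._+ ℤ.- fixedPart as (ρ ∘ Fin.suc)) (sym (ℤP.neg-distribˡ-* a (maybeVal (ρ Fin.zero)))))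
        (sym (ℤP.neg-distrib-+ (a ℤ.* maybeVal (ρ Fin.zero)) (fixedPart as (ρ ∘ Fin.suc))))

module Restrict {N M} (ρ : Restriction N) (σ : Fin M → Fin N) (ren : IsRenaming ρ σ) where

  private
    σ-injective : Injective _≡_ _≡_ σ
    σ-injective = proj₁ ren
    σ-onto : ∀ i → ρ i ≡ nothing → ∃ λ j → σ j ≡ i
    σ-onto = proj₁ (proj₂ ren)
    σ-free : ∀ j → ρ (σ j) ≡ nothing
    σ-free = proj₂ (proj₂ ren)

  freeValue : Vec ℚ M → ∀ i r → ρ i ≡ r → ℚ
  freeValue y i nothing  ρi≡r = lookup y (proj₁ (σ-onto i ρi≡r))
  freeValue y i (just _) _    = 0ℚ

  -- The assignment that agrees with ρ on its domain and reads the free variable σ j from y j;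
  -- freeValue vanishes on the domain of ρ and maybeVal nothing = 0, so the two summands never clash.
  extend : Vec ℚ M → Vec ℚ N
  extend y = tabulate (λ i → freeValue y i (ρ i) refl ℚ.+ ℤ→ℚ (maybeVal (ρ i)))

  freeValue-σ : ∀ y j r (ρσj≡r : ρ (σ j) ≡ r) → freeValue y (σ j) r ρσj≡r ≡ lookup y j
  freeValue-σ y j nothing  ρσj≡r = cong (lookup y) (σ-injective (proj₂ (σ-onto (σ j) ρσj≡r)))
  freeValue-σ y j (just _) ρσj≡r = ⊥-elim (case (trans (sym (σ-free j)) ρσj≡r))
    where
    case : ∀ {b} → nothing ≢ just b
    case ()

  freeValue-fixed : ∀ y i r (ρi≡r : ρ i ≡ r) → (∀ j → σ j ≢ i) → freeValue y i r ρi≡r ≡ 0ℚ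
  freeValue-fixed y i nothing  ρi≡r i∉σ = ⊥-elim (i∉σ _ (proj₂ (σ-onto i ρi≡r)))
  freeValue-fixed y i (just _) _    _   = refl

  restrictCoeffs : Vec ℤ N → Vec ℤ M
  restrictCoeffs a = tabulate (lookup a ∘ σ)

  restrictCoeffs-zeros : restrictCoeffs (zeros N) ≡ zeros M
  restrictCoeffs-zeros = tabulate-zeros _ (λ j → Vec.lookup-replicate (σ j) 0ℤ)

  restrictCoeffs-fixed : ∀ a → (∀ i → i ∈ support a → ρ i ≢ nothing) → restrictCoeffs a ≡ zeros M
  restrictCoeffs-fixed a support⊆dom = tabulate-zeros _ aσ≡0
    where
    aσ≡0 : ∀ j → lookup a (σ j) ≡ 0ℤ
    aσ≡0 j with lookup a (σ j) ℤ.≟ 0ℤ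
    ... | yes aσj≡0 = aσj≡0
    ... | no  aσj≢0 = ⊥-elim (support⊆dom (σ j) (∈-support a (σ j) aσj≢0) (σ-free j))

  dotℚ-extend : ∀ a y → dotℚ a (extend y) ≡ dotℚ (restrictCoeffs a) y ℚ.+ ℤ→ℚ (fixedPart a ρ)
  dotℚ-extend a y = begin
    dotℚ a (extend y)
      ≡⟨ dotℚ≡∑ a (extend y) ⟩
    ∑ (λ i → coeff i ℚ.* lookup (extend y) i)
      ≡⟨ ∑-cong (λ i → trans (cong (coeff i ℚ.*_) (Vec.lookup∘tabulate _ i)) (ℚP.*-distribˡ-+ (coeff i) _ _)) ⟩
    ∑ (λ i → coeff i ℚ.* free i ℚ.+ coeff i ℚ.* ℤ→ℚ (maybeVal (ρ i)))
      ≡⟨ ∑-distrib-+ (λ i → coeff i ℚ.* free i) _ ⟩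
    ∑ (λ i → coeff i ℚ.* free i) ℚ.+ ∑ (λ i → coeff i ℚ.* ℤ→ℚ (maybeVal (ρ i)))
      ≡⟨ cong₂ ℚ._+_ free-sum (sym (ℤ→ℚ-fixedPart a ρ)) ⟩
    dotℚ (restrictCoeffs a) y ℚ.+ ℤ→ℚ (fixedPart a ρ) ∎
    where
    open ≡-Reasoning
    open CommutativeMonoidSum ℚP.+-0-commutativeMonoid using (∑-distrib-+)
    coeff : Fin N → ℚ
    coeff i = ℤ→ℚ (lookup a i)
    free : Fin N → ℚ
    free i = freeValue y i (ρ i) refl
    free-sum : ∑ (λ i → coeff i ℚ.* free i) ≡ dotℚ (restrictCoeffs a) y
    free-sum = begin
      ∑ (λ i → coeff i ℚ.* free i)
        ≡⟨ ∑-reindex σ σ-injective _ (λ i i∉σ → trans (cong (coeff i ℚ.*_) (freeValue-fixed y i (ρ i) refl i∉σ)) (ℚP.*-zeroʳ (coeff i))) ⟩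
      ∑ (λ j → coeff (σ j) ℚ.* free (σ j))
        ≡⟨ ∑-cong (λ j → cong₂ ℚ._*_ (cong ℤ→ℚ (sym (Vec.lookup∘tabulate _ j))) (freeValue-σ y j (ρ (σ j)) refl)) ⟩
      ∑ (λ j → ℤ→ℚ (lookup (restrictCoeffs a) j) ℚ.* lookup y j)
        ≡⟨ dotℚ≡∑ (restrictCoeffs a) y ⟨
      dotℚ (restrictCoeffs a) y ∎

  sat-extend : ∀ y I → Sat y (restrictRename ρ σ I) → Sat (extend y) I
  sat-extend y (ineq a b) sat = subst (ℤ→ℚ b ℚ.≤_) (sym (dotℚ-extend a y)) (begin
    ℤ→ℚ b                                 ≡⟨ solve 2 (λ b f → b := (b :- f) :+ f) refl (ℤ→ℚ b) Fp ⟩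
    ℤ→ℚ b ℚ.- Fp ℚ.+ Fp                   ≡⟨ cong (ℚ._+ Fp) b-fixed ⟨
    ℤ→ℚ (b ℤ.- fixedPart a ρ) ℚ.+ Fp      ≤⟨ ℚP.+-monoˡ-≤ Fp sat ⟩
    dotℚ (restrictCoeffs a) y ℚ.+ Fp      ∎)
    where
    open ℚP.≤-Reasoning
    open ℚ-Solver
    Fp = ℤ→ℚ (fixedPart a ρ)
    b-fixed : ℤ→ℚ (b ℤ.- fixedPart a ρ) ≡ ℤ→ℚ b ℚ.- Fp
    b-fixed = trans (ℤ→ℚ-homo-+ b (ℤ.- fixedPart a ρ)) (cong (ℤ→ℚ b ℚ.+_) (ℤ→ℚ-homo‿- (fixedPart a ρ)))

  sat-triviallyTrue : ∀ y (J : Ineq M) → TriviallyTrue J → Sat y J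
  sat-triviallyTrue y (ineq a b) (a≡0 , b≤0) =
    subst (ℤ→ℚ b ℚ.≤_) (sym (trans (cong (λ a → dotℚ a y) a≡0) (dotℚ-zeroˡ y))) (ℤ→ℚ-mono-≤ b≤0)

  satAll-extend : ∀ {F G} → RestrictsTo F ρ σ G → ∀ y → SatAll y G → SatAll (extend y) F
  satAll-extend {G = G} (F↾ρ⊆G , _) y satG = All.map (λ {I} → sat I) F↾ρ⊆G
    where
    sat : ∀ I → TriviallyTrue (restrictRename ρ σ I) ⊎ restrictRename ρ σ I Membership.∈ G → Sat (extend y) I
    sat I (inj₁ trivial) = sat-extend y I (sat-triviallyTrue y _ trivial)
    sat I (inj₂ I↾ρ∈G)   = sat-extend y I (All.lookup satG I↾ρ∈G)

  restrictTree : SPTree N → SPTree M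
  restrictTree leaf            = leaf
  restrictTree (query a b t u) = query (restrictCoeffs a) (b ℤ.- fixedPart a ρ) (restrictTree t) (restrictTree u)

  spLength-restrictTree : ∀ T → spLength (restrictTree T) ≡ spLength T
  spLength-restrictTree leaf            = refl
  spLength-restrictTree (query a b t u) = cong suc (cong₂ _+_ (spLength-restrictTree t) (spLength-restrictTree u))

  queries-restrictTree : ∀ T → queries (restrictTree T) ≡ map (restrictRename ρ σ) (queries T)
  queries-restrictTree leaf            = refl
  queries-restrictTree (query a b t u) = cong (restrictRename ρ σ (ineq a b) ∷_)
    (trans (cong₂ _++_ (queries-restrictTree t) (queries-restrictTree u)) (sym (List.map-++ _ (queries t) (queries u))))

  restrictRename-complement : ∀ I → restrictRename ρ σ (complement I) ≡ complement (restrictRename ρ σ I)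
  restrictRename-complement (ineq a b) = cong₂ ineq
    (trans (Vec.tabulate-cong (λ j → Vec.lookup-map (σ j) ℤ.-_ a)) (Vec.tabulate-∘ ℤ.-_ (lookup a ∘ σ)))
    (begin
      1ℤ ℤ.- b ℤ.- fixedPart (Vec.map ℤ.-_ a) ρ   ≡⟨ cong (λ f → 1ℤ ℤ.- b ℤ.- f) (fixedPart-neg a ρ) ⟩
      1ℤ ℤ.- b ℤ.- ℤ.- fixedPart a ρ              ≡⟨ solve 2 (λ b f → (con 1ℤ :- b) :- (:- f) := con 1ℤ :- (b :- f)) refl b (fixedPart a ρ) ⟩
      1ℤ ℤ.- (b ℤ.- fixedPart a ρ)                ∎)
    where
    open ≡-Reasoning
    open ℤ-Solver

  validSP-restrict : ∀ {F G} → RestrictsTo F ρ σ G → ∀ {path path′} →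
                     (∀ y → SatAll y path′ → SatAll (extend y) path) →
                     ∀ T → ValidSP F path T → ValidSP G path′ (restrictTree T)
  validSP-restrict F↾ρ≡G {path′ = path′} path′⇒path leaf infeasible (y , satG) =
    infeasible (extend y , All.++⁺ (path′⇒path y (proj₁ sat)) (satAll-extend F↾ρ≡G y (proj₂ sat)))
    where
    sat = All.++⁻ path′ satG
  validSP-restrict F↾ρ≡G {path} {path′} path′⇒path (query a b t u) (valid-t , valid-u) =
    validSP-restrict F↾ρ≡G (extend-path (ineq a b) refl) t valid-t ,
    validSP-restrict F↾ρ≡G (extend-path (complement (ineq a b)) (restrictRename-complement (ineq a b))) u valid-u
    where
    extend-path : ∀ I {I′} → restrictRename ρ σ I ≡ I′ → ∀ y → SatAll y (I′ ∷ path′) → SatAll (extend y) (I ∷ path)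
    extend-path I refl y (sat ∷ sats) = sat-extend y I sat ∷ path′⇒path y sats

  refutation-restrict : ∀ {F G} → RestrictsTo F ρ σ G → ∀ T → SPRefutation F T → SPRefutation G (restrictTree T)
  refutation-restrict F↾ρ≡G = validSP-restrict F↾ρ≡G (λ _ _ → [])

-- The values b - 1 < v < b covered by neither branch a·x ≥ b, a·x ≤ b - 1 of a query.
slab : ℤ → ℚ → Bool
slab b v = does (v ℚP.<? ℤ→ℚ b) ∧ does (ℤ→ℚ b ℚP.<? v ℚ.+ 1ℚ)

inSlab : ∀ {N} → Ineq N → Vec ℚ N → Bool
inSlab (ineq a b) x = slab b (dotℚ a x)

slab-elim : ∀ b v → T (slab b v) → v ℚ.< ℤ→ℚ b × ℤ→ℚ b ℚ.< v ℚ.+ 1ℚ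
slab-elim b v v∈ with Equivalence.to (T-∧ {does (v ℚP.<? ℤ→ℚ b)}) v∈
... | v<b , b<v+1 = T-does⁻¹ (v ℚP.<? ℤ→ℚ b) v<b , T-does⁻¹ (ℤ→ℚ b ℚP.<? v ℚ.+ 1ℚ) b<v+1

slab-intro : ∀ b v → v ℚ.< ℤ→ℚ b → ℤ→ℚ b ℚ.< v ℚ.+ 1ℚ → T (slab b v)
slab-intro b v v<b b<v+1 =
  Equivalence.from T-∧ (T-does (v ℚP.<? ℤ→ℚ b) v<b , T-does (ℤ→ℚ b ℚP.<? v ℚ.+ 1ℚ) b<v+1)

slab-narrow : ∀ b → Narrow (slab b)
slab-narrow b d e d∈ e∈ = ℚP.<-trans (proj₁ (slab-elim b e e∈)) (proj₂ (slab-elim b d d∈))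

0∉slab : ∀ b → ¬ T (slab b 0ℚ)
0∉slab (ℤ.+ zero) 0∈ = ℚP.<-irrefl refl (proj₁ (slab-elim 0ℤ 0ℚ 0∈))
0∉slab +[1+ n ]   0∈ = ℚP.<-irrefl refl (ℚP.≤-<-trans (1≤ℤ→ℚ[1+n] n) (proj₂ (slab-elim +[1+ n ] 0ℚ 0∈)))
0∉slab -[1+ n ]   0∈ =
  ℚP.<-irrefl refl (ℚP.<-≤-trans (proj₁ (slab-elim -[1+ n ] 0ℚ 0∈)) (ℤ→ℚ-mono-≤ { -[1+ n ]} {0ℤ} ℤ.-≤+))

inSlab-intro : ∀ {N} (I : Ineq N) x → ¬ Sat x I → ¬ Sat x (complement I) → T (inSlab I x)
inSlab-intro (ineq a b) x ¬sat ¬sat′ = slab-intro b v (ℚP.≰⇒> ¬sat) b<v+1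
  where
  open ℚ-Solver
  v = dotℚ a x
  -v<1-b : ℚ.- v ℚ.< 1ℚ ℚ.- ℤ→ℚ b
  -v<1-b = subst₂ ℚ._<_ (dotℚ-negˡ a x) (trans (ℤ→ℚ-homo-+ 1ℤ (ℤ.- b)) (cong (1ℚ ℚ.+_) (ℤ→ℚ-homo‿- b))) (ℚP.≰⇒> ¬sat′)
  b<v+1 : ℤ→ℚ b ℚ.< v ℚ.+ 1ℚ
  b<v+1 = subst₂ ℚ._<_ (solve 2 (λ v b → (:- v) :+ (v :+ b) := b) refl v (ℤ→ℚ b))
                       (solve 2 (λ v b → (con 1ℚ :- b) :+ (v :+ b) := v :+ con 1ℚ) refl v (ℤ→ℚ b))
                       (ℚP.+-monoˡ-< (v ℚ.+ ℤ→ℚ b) -v<1-b)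

-- Following the branches that x satisfies must get stuck, as no leaf admits x.
refutation-cover : ∀ {N F path} (τ : SPTree N) → ValidSP F path τ →
                   ∀ x → SatAll x path → SatAll x F → Any (λ I → T (inSlab I x)) (queries τ)
refutation-cover leaf            infeasible         x sat-path satF = ⊥-elim (infeasible (x , All.++⁺ sat-path satF))
refutation-cover (query a b t u) (valid-t , valid-u) x sat-path satF
  with sat? x (ineq a b) | sat? x (complement (ineq a b))
... | yes sat | _        = there (Any.++⁺ˡ (refutation-cover t valid-t x (sat ∷ sat-path) satF))
... | no  _   | yes sat′ = there (Any.++⁺ʳ (queries t) (refutation-cover u valid-u x (sat′ ∷ sat-path) satF))
... | no ¬sat | no ¬sat′ = here (inSlab-intro (ineq a b) x ¬sat ¬sat′)

module WordCounting (W : List ℚ) (vW : ValidW W) where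

  gap : ℚ × ℚ → ℚ
  gap (u , v) = ℚ.∣ u ℚ.- v ∣

  δ : ℚ
  δ = minimum (map gap (cyclicPairs W))

  δ≤gap : All (λ (u , v) → δ ℚ.≤ ℚ.∣ u ℚ.- v ∣) (cyclicPairs W)
  δ≤gap = All.map⁻ (minimum≤ (map gap (cyclicPairs W)))

  0<δ : 0ℚ ℚ.< δ
  0<δ = 0<minimum (All.map⁺ (All.map 0<∣p-q∣ (cyclicPairs-distinct W (proj₁ vW) (proj₂ (proj₂ (proj₂ vW))))))

  L : ℕ
  L = proj₁ (archimedean δ 0<δ)

  1≤[1+L]δ : 1ℚ ℚ.≤ suc L · δ
  1≤[1+L]δ = proj₂ (archimedean δ 0<δ)

  open Anticoncentration W δ (ℚP.<⇒≤ 0<δ) δ≤gap public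

  query-bound : ∀ m {N} (I : Ineq N) → ¬ T (short m I) →
                2 ^ m * count (inSlab I) (words W N) ≤ suc L * (k ^ N * longChains m 0)
  query-bound m {N} (ineq a b) ¬short-I with ¬short (ineq a b) ¬short-I
  ... | inj₁ a≡0 = ≤-trans (≤-reflexive (trans (cong (2 ^ m *_) (count-none 0∉ (words W N))) (*-zeroʳ (2 ^ m)))) z≤n
    where
    0∉ : ∀ x → ¬ T (slab b (dotℚ a x))
    0∉ x = 0∉slab b ∘ subst (T ∘ slab b) (trans (cong (λ a → dotℚ a x) a≡0) (dotℚ-zeroˡ x))
  ... | inj₂ m≤w = begin
    2 ^ m * count (inSlab (ineq a b)) (words W N) ≡⟨ cong (2 ^ m *_) (count-map (slab b) (dotℚ a) (words W N)) ⟨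
    2 ^ m * count (slab b) (values a)              ≤⟨ anticoncentration L 1≤[1+L]δ (slab b) (slab-narrow b) a m m≤w ⟩
    suc L * (k ^ N * longChains m 0)               ∎
    where open ≤-Reasoning

  admissible-bound : ∀ m {N} (G : List (Ineq N)) τ → SPRefutation G τ → All (λ I → ¬ T (short m I)) (queries τ) →
                     2 ^ m * numAdmissible G W ≤ spLength τ * (suc L * (k ^ N * longChains m 0))
  admissible-bound m {N} G τ refutes short-free = begin
    2 ^ m * length (filter (satAll? G) (words W N))
      ≡⟨ cong (2 ^ m *_) (length-filter (satAll? G) (words W N)) ⟩
    2 ^ m * count (does ∘ satAll? G) (words W N)
      ≤⟨ *-monoʳ-≤ (2 ^ m) (count-≤-sum _ inSlab (queries τ) slab-cover (words W N)) ⟩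
    2 ^ m * sum (map (λ I → count (inSlab I) (words W N)) (queries τ))
      ≡⟨ *-distribˡ-sum-map (2 ^ m) (λ I → count (inSlab I) (words W N)) (queries τ) ⟩
    sum (map (λ I → 2 ^ m * count (inSlab I) (words W N)) (queries τ))
      ≤⟨ sum-map-mono (All.map (λ {I} → query-bound m I) short-free) ⟩
    sum (map (const perQuery) (queries τ))
      ≡⟨ sum-map-const perQuery (queries τ) ⟩
    length (queries τ) * perQuery
      ≡⟨ cong (_* perQuery) (length-queries τ) ⟩
    spLength τ * perQuery ∎
    where
    open ≤-Reasoning
    perQuery = suc L * (k ^ N * longChains m 0)
    slab-cover : ∀ x → T (does (satAll? G x)) → Any (λ I → T (inSlab I x)) (queries τ)
    slab-cover x admissible = refutation-cover τ refutes x [] (T-does⁻¹ (satAll? G x) admissible)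

-- Eliminating short queries

module Elimination (𝓕 : Family) (c : ℕ) (SR : SelfReducible c 𝓕) (m : ℕ) where

  record ShortFreeRefutation (n₀ s : ℕ) : Set where
    field
      n          : ℕ
      n₀≤n       : n₀ ≤ n
      tree       : SPTree (ν 𝓕 n)
      refutes    : SPRefutation (F 𝓕 n) tree
      length≡    : spLength tree ≡ s
      short-free : All (λ I → ¬ T (short m I)) (queries tree)

  record Shrunk {n} (τ : SPTree (ν 𝓕 n)) : Set where
    field
      n′             : ℕ
      n∸cm≤n′        : n ∸ c * m ≤ n′
      tree           : SPTree (ν 𝓕 n′)
      refutes        : SPRefutation (F 𝓕 n′) tree
      length≡        : spLength tree ≡ spLength τ
      fewer-nonzeros : count nonzero (queries tree) < count nonzero (queries τ)

  -- Fixing the fewer than m variables of a short query turns it into a zero query;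
  -- zero queries stay zero.
  kill-short : ∀ {n} (τ : SPTree (ν 𝓕 n)) → SPRefutation (F 𝓕 n) τ →
               Any (T ∘ short m) (queries τ) → c * m < n → Shrunk τ
  kill-short {n} τ refutes some-short cm<n = record
    { n′             = n ∸ c * ∣ V ∣
    ; n∸cm≤n′        = ∸-monoʳ-≤ n c∣V∣≤cm
    ; tree           = restrictTree τ
    ; refutes        = refutation-restrict F↾ρ τ refutes
    ; length≡        = spLength-restrictTree τ
    ; fewer-nonzeros = begin-strict
        count nonzero (queries (restrictTree τ))             ≡⟨ cong (count nonzero) (queries-restrictTree τ) ⟩
        count nonzero (map (restrictRename ρ σ) (queries τ)) ≡⟨ count-map nonzero (restrictRename ρ σ) (queries τ) ⟩
        count (nonzero ∘ restrictRename ρ σ) (queries τ)     <⟨ count-mono-< nonzero-restrict I₀-killed ⟩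
        count nonzero (queries τ)                            ∎
    }
    where
    open ≤-Reasoning
    found = Membership.find some-short
    I₀ = proj₁ found
    I₀-short = short-elim m I₀ (proj₂ (proj₂ found))
    V = support (coeffs I₀)
    c∣V∣≤cm : c * ∣ V ∣ ≤ c * m
    c∣V∣≤cm = *-monoʳ-≤ c (<⇒≤ (proj₂ I₀-short))
    restriction = SR n V (≤-<-trans c∣V∣≤cm cm<n)
    ρ = proj₁ restriction
    V⊆dom = proj₁ (proj₂ restriction)
    σ = proj₁ (proj₂ (proj₂ restriction))
    F↾ρ = proj₂ (proj₂ (proj₂ (proj₂ restriction)))
    open Restrict ρ σ (proj₁ (proj₂ (proj₂ (proj₂ restriction))))
    nonzero-restrict : ∀ I → T (nonzero (restrictRename ρ σ I)) → T (nonzero I)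
    nonzero-restrict I nonzero-I↾ρ with Vec.≡-dec ℤ._≟_ (coeffs I) (zeros _)
    ... | yes a≡0 = ⊥-elim (¬nonzero (restrictRename ρ σ I) (trans (cong restrictCoeffs a≡0) restrictCoeffs-zeros) nonzero-I↾ρ)
    ... | no  _   = tt
    I₀-killed : Any (λ I → ¬ T (nonzero (restrictRename ρ σ I)) × T (nonzero I)) (queries τ)
    I₀-killed = Membership.lose (proj₁ (proj₂ found))
      (¬nonzero (restrictRename ρ σ I₀) (restrictCoeffs-fixed (coeffs I₀) V⊆dom) , proj₁ I₀-short)

  eliminate : ∀ n₀ q {n} (τ : SPTree (ν 𝓕 n)) → SPRefutation (F 𝓕 n) τ → count nonzero (queries τ) ≤ q →
              n₀ + c * m * q < n → ShortFreeRefutation n₀ (spLength τ)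
  eliminate n₀ q {n} τ refutes nonzeros≤q room with any? (λ I → T? (short m I)) (queries τ)
  ... | no none-short = record
    { n = n ; n₀≤n = ≤-trans (m≤m+n n₀ _) (<⇒≤ room) ; tree = τ ; refutes = refutes ; length≡ = refl
    ; short-free = All.¬Any⇒All¬ (queries τ) none-short }
  eliminate n₀ zero    τ refutes nonzeros≤0 room | yes some-short =
    contradiction nonzeros≤0 (<⇒≱ (count-pos (Any.map (λ {I} → proj₁ ∘ short-elim m I) some-short)))
  eliminate n₀ (suc q) {n} τ refutes nonzeros≤1+q room | yes some-short =
    subst (ShortFreeRefutation n₀) length≡
      (eliminate n₀ q tree refutes′ (≤-pred (≤-trans fewer-nonzeros nonzeros≤1+q)) (<-≤-trans room′ n∸cm≤n′))
    where
    room′ : n₀ + c * m * q < n ∸ c * m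
    room′ = m+n≤o⇒m≤o∸n (suc (n₀ + c * m * q)) (≤-trans (≤-reflexive (rearrange n₀ (c * m) q)) room)
      where
      rearrange : ∀ n₀ x q → suc (n₀ + x * q) + x ≡ suc (n₀ + x * suc q)
      rearrange = solve-∀
    cm<n : c * m < n
    cm<n = ≤-<-trans (≤-trans (m≤m*n (c * m) (suc q)) (m≤n+m _ n₀)) room
    open Shrunk (kill-short τ refutes some-short cm<n) renaming (refutes to refutes′)

shortFree-bound : ∀ W (vW : ValidW W) 𝓕 c (SR : SelfReducible c 𝓕) nF → IsNF 𝓕 W nF → ∀ m s →
                  Elimination.ShortFreeRefutation 𝓕 c SR m nF s → 2 ^ m ≤ 2 * (s * suc (WordCounting.L W vW)) * longChains m 0
shortFree-bound W vW 𝓕 c SR nF isNF m s R = *-cancelʳ-≤ (2 ^ m) _ K {{m^n≢0 k (ν 𝓕 n) {{k≢0}}}} (begin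
  2 ^ m * K                            ≤⟨ *-monoʳ-≤ (2 ^ m) (isNF n n₀≤n) ⟩
  2 ^ m * (2 * #admissible)            ≡⟨ x[2y]≡2[xy] (2 ^ m) #admissible ⟩
  2 * (2 ^ m * #admissible)            ≤⟨ *-monoʳ-≤ 2 (admissible-bound m (F 𝓕 n) tree refutes short-free) ⟩
  2 * (spLength tree * (X * (K * G)))  ≡⟨ cong (λ s → 2 * (s * (X * (K * G)))) length≡ ⟩
  2 * (s * (X * (K * G)))              ≡⟨ regroup s X K G ⟩
  2 * (s * X) * G * K                  ∎)
  where
  open ≤-Reasoning
  open WordCounting W vW
  open Elimination.ShortFreeRefutation R
  K = k ^ ν 𝓕 n
  #admissible = numAdmissible (F 𝓕 n) W
  X = suc L
  G = longChains m 0
  k≢0 : NonZero k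
  k≢0 = >-nonZero (≤-trans (s≤s z≤n) (proj₂ (proj₂ (proj₂ vW))))
  x[2y]≡2[xy] : ∀ x y → x * (2 * y) ≡ 2 * (x * y)
  x[2y]≡2[xy] = solve-∀
  regroup : ∀ s X K G → 2 * (s * (X * (K * G))) ≡ 2 * (s * X) * G * K
  regroup = solve-∀

room-for-elimination : ∀ n₀ c X s n → 2 * suc n₀ ≤ n → 8 * c * (X * X) * s ^ 4 ≤ n →
                       n₀ + c * (4 * (s * X * (s * X))) * s < n
room-for-elimination n₀ c X s n 2[1+n₀]≤n 8cX²s⁴≤n = *-cancelˡ-≤ 2 (begin
  2 * suc (n₀ + c * (4 * (s * X * (s * X))) * s)        ≡⟨ expand n₀ c X s ⟩
  2 * suc n₀ + 8 * c * (X * X) * (s * s * s)            ≤⟨ +-mono-≤ 2[1+n₀]≤n (≤-trans (*-monoʳ-≤ (8 * c * (X * X)) (s³≤s⁴ s)) 8cX²s⁴≤n) ⟩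
  n + n                                                 ≡⟨ cong (n +_) (+-identityʳ n) ⟨
  2 * n                                                 ∎)
  where
  open ≤-Reasoning
  expand : ∀ n₀ c X s → 2 * suc (n₀ + c * (4 * (s * X * (s * X))) * s) ≡ 2 * suc n₀ + 8 * c * (X * X) * (s * s * s)
  expand = solve-∀
  s³≤s⁴ : ∀ s → s * s * s ≤ s ^ 4
  s³≤s⁴ zero     = z≤n
  s³≤s⁴ (suc s′) = ≤-trans (m≤m*n (suc s′ * suc s′ * suc s′) (suc s′)) (≤-reflexive (s³s≡s⁴ (suc s′)))
    where
    s³s≡s⁴ : ∀ s → s * s * s * s ≡ s * (s * (s * (s * 1)))
    s³s≡s⁴ = solve-∀

mainTheorem9 : (W : List ℚ) → ValidW W →
    (𝓕 : Family) → UnsatisfiableFamily 𝓕 → AlmostFull 𝓕 W →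
    (c : ℕ) → 1 ≤ c → SelfReducible c 𝓕 →
    (∃ λ nF → IsNF 𝓕 W nF × ((n : ℕ) → nF < n → LPFeasible (F 𝓕 n))) →
    ∃ λ d → 1 ≤ d × ∃ λ n₀ → (n : ℕ) → n₀ ≤ n →
      (T : SPTree (ν 𝓕 n)) → SPRefutation (F 𝓕 n) T →
        n ≤ d * spLength T ^ 4
mainTheorem9 W vW 𝓕 _ _ c 1≤c SR (nF , isNF , _) = d , 1≤d , 2 * suc nF , lower-bound
  where
  X = suc (WordCounting.L W vW)
  d = 8 * c * (X * X)
  1≤d : 1 ≤ d
  1≤d = *-mono-≤ (*-mono-≤ {1} {8} (s≤s z≤n) 1≤c) (s≤s z≤n)
  lower-bound : ∀ n → 2 * suc nF ≤ n → (τ : SPTree (ν 𝓕 n)) → SPRefutation (F 𝓕 n) τ → n ≤ d * spLength τ ^ 4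
  lower-bound n 2[1+nF]≤n τ refutes with n ≤? d * spLength τ ^ 4
  ... | yes n≤ds⁴ = n≤ds⁴
  ... | no  n≰ds⁴ = contradiction (shortFree-bound W vW 𝓕 c SR nF isNF m s short-free) (<⇒≱ (longChains-sparse (s * X)))
    where
    s = spLength τ
    m = 4 * (s * X * (s * X))
    short-free = Elimination.eliminate 𝓕 c SR m nF s τ refutes
      (≤-trans (count-≤-length nonzero (queries τ)) (≤-reflexive (length-queries τ)))
      (room-for-elimination nF c X s n 2[1+nF]≤n (<⇒≤ (≰⇒> n≰ds⁴)))
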